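{- Let $r\ge2$ and assume $\mathfrak{f}=(t-\zeta)\mathfrak{m}$ with $\zeta\in\mathbb{F}_q$ and $\mathfrak{m}\in\mathbb{F}_q[t]$ monic. Then for any index $l\in\{1,\dots,r\}$, $$\operatorname{O}^{(r)}_{\mathfrak{f}}(X_1,\dots,X_r)=\mathfrak{m}(X_l)\operatorname{O}^{(r-1)}_{\mathfrak{f}}(X_1,\dots,\widehat{X_l},\dots,X_r)+\prod_{j\ne l,\,1\le j\le r}(X_j-\zeta)\operatorname{O}^{(r)}_{\mathfrak{m}}(X_1,\dots,X_r),$$ where $\widehat{X_l}$ means $X_l$ is omitted.
   Context: Let $\mathbb{F}_q$ be a finite field. For a monic $\mathfrak{g}(t)=b_mt^m+\cdots+b_0\in\mathbb{F}_q[t]$ of degree $m\ge1$, define $\operatorname{D}_{\mathfrak{g}}$ on polynomials of degree $<m$ in a variable $X$ by $\operatorname{D}_{\mathfrak{g}}(X^i)=\sum_{j=0}^{m-i-1}b_{i+j+1}X^j$; Weil operators $\operatorname{O}^{(1)}_{\mathfrak{g}}=1$, $\operatorname{O}^{(2)}_{\mathfrak{g}}(X_1,X_2)=\sum_{k=0}^{m-1}\operatorname{D}_{\mathfrak{g}}(X_1^k)X_2^k$, and for $s>2$, $\operatorname{O}^{(s)}_{\mathfrak{g}}(X_1,\dots,X_s)$ the unique polynomial whose degree in each $X_i$ is $<m$ and which is congruent to $\prod_{j=1}^{s-1}\operatorname{O}^{(2)}_{\mathfrak{g}}(X_j,X_s)$ modulo $\mathfrak{g}(X_s)$. If $\mathfrak{m}=1$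 (degree $0$), $\operatorname{O}^{(r)}_{\mathfrak{m}}$ is to be read as $0$. -}

module Defs where

open import Level using (Level; _⊔_)
open import Algebra.Bundles using (CommutativeRing)
open import Data.Nat using (ℕ; zero; suc; _∸_) renaming (_+_ to _+ℕ_)
open import Data.Fin using (Fin; zero; suc; fromℕ; inject₁)
open import Data.List using (List; []; _∷_; map; foldr; _++_; upTo; allFin; length)
open import Data.Vec using (Vec; []; _∷_; zipWith; init; last; replicate; fromList; toList)
open import Data.Product using (_×_; Σ; ∃)
open import Data.Unit.Polymorphic using (⊤)
open import Relation.Nullary using (¬_)

-- Generic list (dense univariate) polynomial operations.
-- A list  a₀ ∷ a₁ ∷ … ∷ aₖ ∷ []  represents  a₀ + a₁ Y + … + aₖ Yᵏ.

addL : ∀ {a} {A : Set a} → (A → A → A) → List A → List A → List A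
addL f []       q        = q
addL f (x ∷ p)  []       = x ∷ p
addL f (x ∷ p)  (y ∷ q)  = f x y ∷ addL f p q

mulL : ∀ {a} {A : Set a} → A → (A → A → A) → (A → A → A) → List A → List A → List A
mulL z ad mu []      q = []
mulL z ad mu (x ∷ p) q = addL ad (map (mu x) q) (z ∷ mulL z ad mu p q)

eqL : ∀ {a ℓ} {A : Set a} → (A → Set ℓ) → (A → A → Set ℓ) → List A → List A → Set ℓ
eqL isZ e []      []      = ⊤
eqL isZ e []      (y ∷ q) = isZ y × eqL isZ e [] q
eqL isZ e (x ∷ p) []      = isZ x × eqL isZ e p []
eqL isZ e (x ∷ p) (y ∷ q) = e x y × eqL isZ e p q

module _ {c ℓ} (R : CommutativeRing c ℓ) where
  open CommutativeRing R using (Carrier; _≈_; _*_; 0#; 1#)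

  IsFiniteField : Set (c ⊔ ℓ)
  IsFiniteField =
    (¬ (0# ≈ 1#))
    × (∀ x → ¬ (x ≈ 0#) → ∃ λ y → x * y ≈ 1#)
    × (∃ λ (n : ℕ) → ∃ λ (enum : Fin n → Carrier) → ∀ x → ∃ λ i → enum i ≈ x)

-- Multivariate polynomials over R in variables X₀ … X_{n-1}.
-- pol : Poly (suc n) = polynomials in X₀ with coefficients in Poly n
-- (the latter in the variables X₁ … Xₙ).

module Poly {c ℓ} (R : CommutativeRing c ℓ) where
  open CommutativeRing R using (Carrier; _≈_; _+_; _*_; -_; 0#; 1#)

  data Poly : ℕ → Set c where
    cst : Carrier → Poly zero
    pol : ∀ {n} → List (Poly n) → Poly (suc n)

  0P : ∀ {n} → Poly n
  0P {zero}  = cst 0#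
  0P {suc n} = pol []

  1P : ∀ {n} → Poly n
  1P {zero}  = cst 1#
  1P {suc n} = pol (1P ∷ [])

  infixl 6 _+P_ _-P_
  infixl 7 _*P_
  infix  4 _≈P_

  _+P_ : ∀ {n} → Poly n → Poly n → Poly n
  cst a +P cst b = cst (a + b)
  pol p +P pol q = pol (addL _+P_ p q)

  -P_ : ∀ {n} → Poly n → Poly n
  -P cst a = cst (- a)
  -P pol p = pol (map -P_ p)

  _-P_ : ∀ {n} → Poly n → Poly n → Poly n
  p -P q = p +P (-P q)

  _*P_ : ∀ {n} → Poly n → Poly n → Poly n
  cst a *P cst b = cst (a * b)
  pol p *P pol q = pol (mulL 0P _+P_ _*P_ p q)

  _≈P_ : ∀ {n} → Poly n → Poly n → Set ℓ
  cst a ≈P cst b = a ≈ b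
  pol p ≈P pol q = eqL (λ a → a ≈P 0P) _≈P_ p q

  constP : ∀ {n} → Carrier → Poly n
  constP {zero}  a = cst a
  constP {suc n} a = pol (constP a ∷ [])

  var : ∀ {n} → Fin n → Poly n
  var {suc n} zero    = pol (0P ∷ 1P ∷ [])
  var {suc n} (suc i) = pol (var i ∷ [])

  powP : ∀ {n} → Poly n → ℕ → Poly n
  powP p zero    = 1P
  powP p (suc k) = p *P powP p k

  sumP : ∀ {n} → List (Poly n) → Poly n
  sumP = foldr _+P_ 0P

  prodP : ∀ {n} → List (Poly n) → Poly n
  prodP = foldr _*P_ 1P

  substP : ∀ {n k} → (Fin n → Poly k) → Poly n → Poly k
  substP ρ (cst a) = constP a
  substP ρ (pol p) = foldr (λ a acc → substP (λ i → ρ (suc i)) a +P (ρ zero *P acc)) 0P p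

  -- Monic univariate polynomials  g = b₀ + b₁ t + … + b_{m-1} t^{m-1} + t^m
  -- are represented by the list  b₀ ∷ … ∷ b_{m-1} ∷ []  of lower coefficients;
  -- deg g = m = length of the list.  The empty list is g = 1.

  Monic : Set c
  Monic = List Carrier

  deg : Monic → ℕ
  deg = length

  coeff : Monic → ℕ → Carrier
  coeff []       zero    = 1#
  coeff []       (suc i) = 0#
  coeff (b ∷ bs) zero    = b
  coeff (b ∷ bs) (suc i) = coeff bs i

  toPoly : Monic → Poly 1
  toPoly bs = pol (map cst bs ++ (cst 1# ∷ []))

  -- D_g(X^i) = Σ_{j=0}^{m-i-1} b_{i+j+1} X^j   (as polynomial in one variable)
  Dmono : Monic → ℕ → Poly 1
  Dmono g i = sumP (map (λ j → constP (coeff g (i +ℕ j +ℕ 1)) *P powP (var zero) j)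
                        (upTo (deg g ∸ i)))

  -- O^{(2)}_g(X₁,X₂) = Σ_{k=0}^{m-1} D_g(X₁^k) X₂^k   (X₁ ↦ var 0, X₂ ↦ var 1)
  O2 : Monic → Poly 2
  O2 g = sumP (map (λ k → substP (λ _ → var zero) (Dmono g k) *P powP (var (suc zero)) k)
                   (upTo (deg g)))

  -- remainder modulo the monic g in the outermost variable X₀
  -- step b c r  =  (c + X₀ r) mod g, for r of degree < m
  step : ∀ {n m} → Vec Carrier m → Poly n → Vec (Poly n) m → Vec (Poly n) m
  step {m = zero}  bv c r = []
  step {m = suc m} bv c r = zipWith (λ s b → s -P (last r *P constP b)) (c ∷ init r) bv

  remTop : ∀ {n} → Monic → Poly (suc n) → Poly (suc n)
  remTop g (pol p) = pol (toList (foldr (step (fromList g)) (replicate _ 0P) p))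

  -- O^{(s)}_g for s ≥ 3: the polynomial of degree < m in every variable that is
  -- congruent to  Π_{j=1}^{s-1} O^{(2)}_g(X_j, X_s)  modulo g(X_s).
  -- Computed with X_s placed as outermost variable (index 0), reduced there, and then
  -- the variables are renamed back to X₁ … X_s (indices 0 … s-1).
  Ohigh : Monic → (k : ℕ) → Poly (suc (suc (suc k)))
  Ohigh g k = substP ρ (remTop g prodTop)
    where
      prodTop : Poly (suc (suc (suc k)))
      prodTop = prodP (map (λ (j : Fin (suc (suc k))) →
                              substP (λ { zero → var (suc j) ; (suc _) → var zero }) (O2 g))
                           (allFin (suc (suc k))))
      ρ : Fin (suc (suc (suc k))) → Poly (suc (suc (suc k)))
      ρ zero    = var (fromℕ (suc (suc k)))
      ρ (suc j) = var (inject₁ j)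

  -- Weil operators O^{(s)}_g(X₁,…,X_s), variables X_i ↦ var (i-1).
  -- Convention: if g = 1 (degree 0) the operator is 0.  (s = 0 is not used.)
  Weil : Monic → (s : ℕ) → Poly s
  Weil []      s                     = 0P
  Weil (b ∷ g) zero                  = 0P
  Weil (b ∷ g) (suc zero)            = 1P
  Weil (b ∷ g) (suc (suc zero))      = O2 (b ∷ g)
  Weil (b ∷ g) (suc (suc (suc k)))   = Ohigh (b ∷ g) k

{-# OPTIONS --safe #-}
-- O⁽ʳ⁾_g is the remainder of Π_{j<r} O⁽²⁾_g(X_j, X_r) modulo g(X_r), and a polynomial of degree
-- below deg g in X_r is determined by its class modulo the monic g(X_r).  So it suffices to show
-- that the right-hand side has degree below deg 𝔣 in X_r and is congruent to that product modulo
-- 𝔣(X_r) = (X_r - ζ) 𝔪(X_r).  Both follow from  O⁽²⁾_𝔣(X, Y) = 𝔪(X) + (Y - ζ) O⁽²⁾_𝔪(X, Y),  which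
-- holds because both sides, multiplied by X - Y, give 𝔣(X) - 𝔣(Y).  This settles every l < r.
-- The case l = r reduces to l = r - 1 because O⁽ʳ⁾ is symmetric in X_{r-1} and X_r: a polynomial
-- of degree below deg g in both variables that lies in the ideal (g(X_{r-1}), g(X_r)) vanishes.
module Submission where

open import Defs
open import Level using (0ℓ; _⊔_)
open import Algebra.Bundles using (CommutativeRing; RawRing)
open import Algebra.Structures using (IsCommutativeRing)
import Algebra.Properties.Ring
import Algebra.Solver.Ring
open import Algebra.Solver.Ring.AlmostCommutativeRing using (fromCommutativeRing; _-Raw-AlmostCommutative⟶_)
open import Data.Empty using (⊥-elim)
open import Data.Fin using (Fin; zero; suc; punchIn; fromℕ; inject₁)
import Data.Fin as Fin
import Data.Fin.Properties as Fin
import Data.Fin.Relation.Unary.Top as Top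
open import Data.List as List using (List; []; _∷_; map; foldr; length; _++_; allFin; applyUpTo)
open import Data.List.Properties using (length-map; length-++; length-applyUpTo; map-tabulate)
open import Data.Maybe using (Maybe; just; nothing)
open import Data.Nat as ℕ using (ℕ; zero; suc; _≤_; _<_; z≤n; s≤s)
import Data.Nat.Properties as ℕ
open import Data.Product using (_×_; _,_)
open import Data.Unit.Polymorphic using (tt)
open import Data.Vec as Vec using (Vec; []; _∷_; toList)
open import Data.Vec.Properties using (toList-map; toList∘fromList; length-toList)
open import Relation.Binary.PropositionalEquality as ≡ using (_≡_)
import Relation.Binary.Reasoning.Setoid
open import Relation.Binary.Structures using (IsEquivalence)
open import Relation.Nullary using (¬_; yes; no; contradiction)

module CoefficientList {a ℓ} (A : CommutativeRing a ℓ) where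
  open CommutativeRing A hiding (zero)
  open import Relation.Binary.Reasoning.Setoid setoid
  open import Algebra.Properties.CommutativeSemigroup +-commutativeSemigroup using (interchange; x∙yz≈y∙xz)
  open import Algebra.Properties.Ring ring using (-0#≈0#)

  infix  4 _≋_ _≈ᶜ_
  infixl 6 _+L_
  infixl 7 _*L_

  _+L_ _*L_ : List Carrier → List Carrier → List Carrier
  _+L_ = addL _+_
  _*L_ = mulL 0# _+_ _*_

  -L_ : List Carrier → List Carrier
  -L_ = map (-_)

  scale : Carrier → List Carrier → List Carrier
  scale x = map (x *_)

  _≋_ : List Carrier → List Carrier → Set ℓ
  _≋_ = eqL (_≈ 0#) _≈_

  coefficient : List Carrier → ℕ → Carrier
  coefficient []      _       = 0#
  coefficient (x ∷ p) zero    = x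
  coefficient (x ∷ p) (suc i) = coefficient p i

  record _≈ᶜ_ (p q : List Carrier) : Set ℓ where
    constructor coefficientwise
    field at : ∀ i → coefficient p i ≈ coefficient q i
  open _≈ᶜ_ public

  ≋⇒≈ᶜ : ∀ p q → p ≋ q → p ≈ᶜ q
  ≋⇒≈ᶜ p q e = coefficientwise (go p q e)
    where
    go : ∀ p q → p ≋ q → ∀ i → coefficient p i ≈ coefficient q i
    go []      []      _        _       = refl
    go []      (y ∷ q) (y≈0 , _) zero    = sym y≈0
    go []      (y ∷ q) (_ , e)   (suc i) = go [] q e i
    go (x ∷ p) []      (x≈0 , _) zero    = x≈0
    go (x ∷ p) []      (_ , e)   (suc i) = go p [] e i
    go (x ∷ p) (y ∷ q) (x≈y , _) zero    = x≈y
    go (x ∷ p) (y ∷ q) (_ , e)   (suc i) = go p q e i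

  ≈ᶜ⇒≋ : ∀ p q → p ≈ᶜ q → p ≋ q
  ≈ᶜ⇒≋ p q e = go p q (at e)
    where
    go : ∀ p q → (∀ i → coefficient p i ≈ coefficient q i) → p ≋ q
    go []      []      e = tt
    go []      (y ∷ q) e = sym (e zero) , go [] q (λ i → e (suc i))
    go (x ∷ p) []      e = e zero , go p [] (λ i → e (suc i))
    go (x ∷ p) (y ∷ q) e = e zero , go p q (λ i → e (suc i))

  coefficient-+ : ∀ p q i → coefficient (p +L q) i ≈ coefficient p i + coefficient q i
  coefficient-+ []      q       i       = sym (+-identityˡ _)
  coefficient-+ (x ∷ p) []      i       = sym (+-identityʳ _)
  coefficient-+ (x ∷ p) (y ∷ q) zero    = refl
  coefficient-+ (x ∷ p) (y ∷ q) (suc i) = coefficient-+ p q i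

  coefficient-map : ∀ f → f 0# ≈ 0# → ∀ p i → coefficient (map f p) i ≈ f (coefficient p i)
  coefficient-map f f0≈0 []      i       = sym f0≈0
  coefficient-map f f0≈0 (x ∷ p) zero    = refl
  coefficient-map f f0≈0 (x ∷ p) (suc i) = coefficient-map f f0≈0 p i

  coefficient-neg : ∀ p i → coefficient (-L p) i ≈ - coefficient p i
  coefficient-neg = coefficient-map -_ -0#≈0#

  coefficient-scale : ∀ x p i → coefficient (scale x p) i ≈ x * coefficient p i
  coefficient-scale x = coefficient-map (x *_) (zeroʳ x)

  coefficient-*-cons : ∀ x p q i →
    coefficient ((x ∷ p) *L q) i ≈ x * coefficient q i + coefficient (0# ∷ p *L q) i
  coefficient-*-cons x p q i =
    trans (coefficient-+ (scale x q) (0# ∷ p *L q) i) (+-cong (coefficient-scale x q i) refl)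

  ≈ᶜ-refl : ∀ {p} → p ≈ᶜ p
  ≈ᶜ-refl = coefficientwise λ _ → refl

  ≈ᶜ-sym : ∀ {p q} → p ≈ᶜ q → q ≈ᶜ p
  ≈ᶜ-sym e = coefficientwise λ i → sym (at e i)

  ≈ᶜ-trans : ∀ {p q r} → p ≈ᶜ q → q ≈ᶜ r → p ≈ᶜ r
  ≈ᶜ-trans e f = coefficientwise λ i → trans (at e i) (at f i)

  ∷-cong : ∀ {x y p q} → x ≈ y → p ≈ᶜ q → x ∷ p ≈ᶜ y ∷ q
  ∷-cong x≈y e = coefficientwise λ { zero → x≈y ; (suc i) → at e i }

  +L-cong : ∀ {p p′ q q′} → p ≈ᶜ p′ → q ≈ᶜ q′ → p +L q ≈ᶜ p′ +L q′
  +L-cong {p} {p′} {q} {q′} e f = coefficientwise λ i →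
    trans (coefficient-+ p q i) (trans (+-cong (at e i) (at f i)) (sym (coefficient-+ p′ q′ i)))

  -L-cong : ∀ {p q} → p ≈ᶜ q → -L p ≈ᶜ -L q
  -L-cong {p} {q} e = coefficientwise λ i →
    trans (coefficient-neg p i) (trans (-‿cong (at e i)) (sym (coefficient-neg q i)))

  scale-cong : ∀ x {q q′} → q ≈ᶜ q′ → scale x q ≈ᶜ scale x q′
  scale-cong x {q} {q′} e = coefficientwise λ i →
    trans (coefficient-scale x q i) (trans (*-cong refl (at e i)) (sym (coefficient-scale x q′ i)))

  +L-assoc : ∀ p q r → (p +L q) +L r ≈ᶜ p +L (q +L r)
  +L-assoc p q r = coefficientwise λ i → begin
    coefficient (p +L q +L r) i                         ≈⟨ coefficient-+ (p +L q) r i ⟩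
    coefficient (p +L q) i + coefficient r i            ≈⟨ +-cong (coefficient-+ p q i) refl ⟩
    coefficient p i + coefficient q i + coefficient r i ≈⟨ +-assoc _ _ _ ⟩
    coefficient p i + (coefficient q i + coefficient r i) ≈⟨ +-cong refl (coefficient-+ q r i) ⟨
    coefficient p i + coefficient (q +L r) i            ≈⟨ coefficient-+ p (q +L r) i ⟨
    coefficient (p +L (q +L r)) i                       ∎

  +L-comm : ∀ p q → p +L q ≈ᶜ q +L p
  +L-comm p q = coefficientwise λ i →
    trans (coefficient-+ p q i) (trans (+-comm _ _) (sym (coefficient-+ q p i)))

  +L-interchange : ∀ p q r s → (p +L q) +L (r +L s) ≈ᶜ (p +L r) +L (q +L s)
  +L-interchange p q r s = coefficientwise λ i → begin
    coefficient ((p +L q) +L (r +L s)) i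
      ≈⟨ trans (coefficient-+ (p +L q) (r +L s) i) (+-cong (coefficient-+ p q i) (coefficient-+ r s i)) ⟩
    (coefficient p i + coefficient q i) + (coefficient r i + coefficient s i)
      ≈⟨ interchange _ _ _ _ ⟩
    (coefficient p i + coefficient r i) + (coefficient q i + coefficient s i)
      ≈⟨ trans (coefficient-+ (p +L r) (q +L s) i) (+-cong (coefficient-+ p r i) (coefficient-+ q s i)) ⟨
    coefficient ((p +L r) +L (q +L s)) i ∎

  +L-identityʳ : ∀ p → p +L [] ≈ᶜ p
  +L-identityʳ p = coefficientwise λ i → trans (coefficient-+ p [] i) (+-identityʳ _)

  -L-inverseˡ : ∀ p → -L p +L p ≈ᶜ []
  -L-inverseˡ p = coefficientwise λ i →
    trans (coefficient-+ (-L p) p i) (trans (+-cong (coefficient-neg p i) refl) (-‿inverseˡ _))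

  -L-inverseʳ : ∀ p → p +L -L p ≈ᶜ []
  -L-inverseʳ p = coefficientwise λ i →
    trans (coefficient-+ p (-L p) i) (trans (+-cong refl (coefficient-neg p i)) (-‿inverseʳ _))

  *L-zeroʳ : ∀ p → p *L [] ≈ᶜ []
  *L-zeroʳ []      = ≈ᶜ-refl
  *L-zeroʳ (x ∷ p) = coefficientwise λ { zero → refl ; (suc i) → at (*L-zeroʳ p) i }

  *L-congʳ : ∀ p {q q′} → q ≈ᶜ q′ → p *L q ≈ᶜ p *L q′
  *L-congʳ []      e = ≈ᶜ-refl
  *L-congʳ (x ∷ p) e = +L-cong (scale-cong x e) (∷-cong refl (*L-congʳ p e))

  *L-consʳ : ∀ p y q → p *L (y ∷ q) ≈ᶜ scale y p +L (0# ∷ p *L q)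
  *L-consʳ []      y q = coefficientwise λ { zero → refl ; (suc i) → refl }
  *L-consʳ (x ∷ p) y q = coefficientwise λ
    { zero    → trans (coefficient-*-cons x p (y ∷ q) zero) (+-cong (*-comm x y) refl)
    ; (suc i) → begin
        coefficient ((x ∷ p) *L (y ∷ q)) (suc i)
          ≈⟨ trans (coefficient-+ (scale x q) (p *L (y ∷ q)) i) (+-cong (coefficient-scale x q i) refl) ⟩
        x * coefficient q i + coefficient (p *L (y ∷ q)) i
          ≈⟨ +-cong refl (trans (at (*L-consʳ p y q) i) (coefficient-+ (scale y p) (0# ∷ p *L q) i)) ⟩
        x * coefficient q i + (coefficient (scale y p) i + coefficient (0# ∷ p *L q) i)
          ≈⟨ x∙yz≈y∙xz _ _ _ ⟩
        coefficient (scale y p) i + (x * coefficient q i + coefficient (0# ∷ p *L q) i)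
          ≈⟨ +-cong refl (coefficient-*-cons x p q i) ⟨
        coefficient (scale y p) i + coefficient ((x ∷ p) *L q) i
          ≈⟨ coefficient-+ (scale y (x ∷ p)) (0# ∷ (x ∷ p) *L q) (suc i) ⟨
        coefficient (scale y (x ∷ p) +L (0# ∷ (x ∷ p) *L q)) (suc i) ∎ }

  *L-comm : ∀ p q → p *L q ≈ᶜ q *L p
  *L-comm p []      = *L-zeroʳ p
  *L-comm p (y ∷ q) = ≈ᶜ-trans (*L-consʳ p y q) (+L-cong ≈ᶜ-refl (∷-cong refl (*L-comm p q)))

  scale-+L : ∀ x q r → scale x (q +L r) ≈ᶜ scale x q +L scale x r
  scale-+L x q r = coefficientwise λ i → begin
    coefficient (scale x (q +L r)) i            ≈⟨ coefficient-scale x (q +L r) i ⟩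
    x * coefficient (q +L r) i                  ≈⟨ *-cong refl (coefficient-+ q r i) ⟩
    x * (coefficient q i + coefficient r i)     ≈⟨ distribˡ _ _ _ ⟩
    x * coefficient q i + x * coefficient r i   ≈⟨ +-cong (coefficient-scale x q i) (coefficient-scale x r i) ⟨
    coefficient (scale x q) i + coefficient (scale x r) i ≈⟨ coefficient-+ (scale x q) (scale x r) i ⟨
    coefficient (scale x q +L scale x r) i      ∎

  *L-distribˡ : ∀ p q r → p *L (q +L r) ≈ᶜ p *L q +L p *L r
  *L-distribˡ []      q r = ≈ᶜ-refl
  *L-distribˡ (x ∷ p) q r = ≈ᶜ-trans
    (+L-cong (scale-+L x q r) (∷-cong (sym (+-identityʳ 0#)) (*L-distribˡ p q r)))
    (+L-interchange (scale x q) (scale x r) (0# ∷ p *L q) (0# ∷ p *L r))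

  *L-distribʳ : ∀ p q r → (q +L r) *L p ≈ᶜ q *L p +L r *L p
  *L-distribʳ p q r = ≈ᶜ-trans (*L-comm (q +L r) p)
    (≈ᶜ-trans (*L-distribˡ p q r) (+L-cong (*L-comm p q) (*L-comm p r)))

  *L-cong : ∀ {p p′ q q′} → p ≈ᶜ p′ → q ≈ᶜ q′ → p *L q ≈ᶜ p′ *L q′
  *L-cong {p} {p′} {q} {q′} e f =
    ≈ᶜ-trans (*L-comm p q) (≈ᶜ-trans (*L-congʳ q e) (≈ᶜ-trans (*L-comm q p′) (*L-congʳ p′ f)))

  scale-*L : ∀ x q r → scale x q *L r ≈ᶜ scale x (q *L r)
  scale-*L x []      r = ≈ᶜ-refl
  scale-*L x (y ∷ q) r = coefficientwise λ i → begin
    coefficient ((x * y ∷ scale x q) *L r) i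
      ≈⟨ coefficient-*-cons (x * y) (scale x q) r i ⟩
    x * y * coefficient r i + coefficient (0# ∷ scale x q *L r) i
      ≈⟨ +-cong (*-assoc _ _ _) (at (∷-cong (sym (zeroʳ x)) (scale-*L x q r)) i) ⟩
    x * (y * coefficient r i) + coefficient (scale x (0# ∷ q *L r)) i
      ≈⟨ +-cong refl (coefficient-scale x (0# ∷ q *L r) i) ⟩
    x * (y * coefficient r i) + x * coefficient (0# ∷ q *L r) i
      ≈⟨ distribˡ _ _ _ ⟨
    x * (y * coefficient r i + coefficient (0# ∷ q *L r) i)
      ≈⟨ *-cong refl (coefficient-*-cons y q r i) ⟨
    x * coefficient ((y ∷ q) *L r) i
      ≈⟨ coefficient-scale x ((y ∷ q) *L r) i ⟨
    coefficient (scale x ((y ∷ q) *L r)) i ∎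

  shift-*L : ∀ p q → (0# ∷ p) *L q ≈ᶜ 0# ∷ p *L q
  shift-*L p q = coefficientwise λ i →
    trans (coefficient-*-cons 0# p q i) (trans (+-cong (zeroˡ _) refl) (+-identityˡ _))

  *L-assoc : ∀ p q r → (p *L q) *L r ≈ᶜ p *L (q *L r)
  *L-assoc []      q r = ≈ᶜ-refl
  *L-assoc (x ∷ p) q r = ≈ᶜ-trans (*L-distribʳ r (scale x q) (0# ∷ p *L q))
    (+L-cong (scale-*L x q r) (≈ᶜ-trans (shift-*L (p *L q) r) (∷-cong refl (*L-assoc p q r))))

  *L-identityˡ : ∀ p → (1# ∷ []) *L p ≈ᶜ p
  *L-identityˡ p = ≈ᶜ-trans (+L-cong scale-1# [0]≈ᶜ[]) (+L-identityʳ p)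
    where
    scale-1# : scale 1# p ≈ᶜ p
    scale-1# = coefficientwise λ i → trans (coefficient-scale 1# p i) (*-identityˡ _)
    [0]≈ᶜ[] : 0# ∷ [] ≈ᶜ []
    [0]≈ᶜ[] = coefficientwise λ { zero → refl ; (suc i) → refl }

  ≋-isEquivalence : IsEquivalence _≋_
  ≋-isEquivalence = record
    { refl  = λ {p} → ≈ᶜ⇒≋ p p ≈ᶜ-refl
    ; sym   = λ {p} {q} e → ≈ᶜ⇒≋ q p (≈ᶜ-sym (≋⇒≈ᶜ p q e))
    ; trans = λ {p} {q} {r} e f → ≈ᶜ⇒≋ p r (≈ᶜ-trans (≋⇒≈ᶜ p q e) (≋⇒≈ᶜ q r f))
    }

  ≋-isCommutativeRing : IsCommutativeRing _≋_ _+L_ _*L_ -L_ [] (1# ∷ [])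
  ≋-isCommutativeRing = record
    { isRing = record
      { +-isAbelianGroup = record
        { isGroup = record
          { isMonoid = record
            { isSemigroup = record
              { isMagma = record
                { isEquivalence = ≋-isEquivalence
                ; ∙-cong        = λ e f → ↑ (+L-cong (↓ e) (↓ f))
                }
              ; assoc = λ p q r → ↑ (+L-assoc p q r)
              }
            ; identity = (λ p → ↑ ≈ᶜ-refl) , (λ p → ↑ (+L-identityʳ p))
            }
          ; inverse = (λ p → ↑ (-L-inverseˡ p)) , (λ p → ↑ (-L-inverseʳ p))
          ; ⁻¹-cong = λ e → ↑ (-L-cong (↓ e))
          }
        ; comm = λ p q → ↑ (+L-comm p q)
        }
      ; *-cong     = λ e f → ↑ (*L-cong (↓ e) (↓ f))
      ; *-assoc    = λ p q r → ↑ (*L-assoc p q r)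
      ; *-identity = (λ p → ↑ (*L-identityˡ p)) , (λ p → ↑ (≈ᶜ-trans (*L-comm p (1# ∷ [])) (*L-identityˡ p)))
      ; distrib    = (λ p q r → ↑ (*L-distribˡ p q r)) , (λ p q r → ↑ (*L-distribʳ p q r))
      }
    ; *-comm = λ p q → ↑ (*L-comm p q)
    }
    where
    ↑ : ∀ {p q} → p ≈ᶜ q → p ≋ q
    ↑ = ≈ᶜ⇒≋ _ _
    ↓ : ∀ {p q} → p ≋ q → p ≈ᶜ q
    ↓ = ≋⇒≈ᶜ _ _

  DegreeBelow : List Carrier → ℕ → Set ℓ
  DegreeBelow p t = ∀ i → t ≤ i → coefficient p i ≈ 0#

  degreeBelow-mono : ∀ p {s t} → s ≤ t → DegreeBelow p s → DegreeBelow p t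
  degreeBelow-mono _ s≤t b i t≤i = b i (ℕ.≤-trans s≤t t≤i)

  degreeBelow-length : ∀ p → DegreeBelow p (length p)
  degreeBelow-length []      i       _         = refl
  degreeBelow-length (x ∷ p) (suc i) (s≤s le) = degreeBelow-length p i le

  degreeBelow-0 : ∀ {q} → DegreeBelow q 0 → q ≈ᶜ []
  degreeBelow-0 b = coefficientwise λ i → b i z≤n

  monic : List Carrier → List Carrier
  monic hs = hs ++ 1# ∷ []

  coefficient-monic-top : ∀ hs → coefficient (monic hs) (length hs) ≈ 1#
  coefficient-monic-top []       = refl
  coefficient-monic-top (h ∷ hs) = coefficient-monic-top hs

  coefficient-monic-beyond : ∀ hs i → length hs < i → coefficient (monic hs) i ≈ 0#
  coefficient-monic-beyond []       (suc i) _        = refl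
  coefficient-monic-beyond (h ∷ hs) (suc i) (s≤s lt) = coefficient-monic-beyond hs i lt

  degreeBelow-tail : ∀ hs t x q → DegreeBelow ((x ∷ q) *L monic hs) (suc (length hs ℕ.+ t)) →
                     DegreeBelow (q *L monic hs) (length hs ℕ.+ t)
  degreeBelow-tail hs t x q b i le = begin
    coefficient (q *L monic hs) i
      ≈⟨ +-identityˡ _ ⟨
    0# + coefficient (q *L monic hs) i
      ≈⟨ +-cong (trans (*-cong refl (coefficient-monic-beyond hs (suc i) (s≤s (ℕ.m+n≤o⇒m≤o _ le)))) (zeroʳ x)) refl ⟨
    x * coefficient (monic hs) (suc i) + coefficient (q *L monic hs) i
      ≈⟨ coefficient-*-cons x q (monic hs) (suc i) ⟨
    coefficient ((x ∷ q) *L monic hs) (suc i)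
      ≈⟨ b (suc i) (s≤s le) ⟩
    0# ∎

  degreeBelow-*-monic : ∀ hs t q → DegreeBelow (q *L monic hs) (length hs ℕ.+ t) → DegreeBelow q t
  degreeBelow-*-monic hs t       []      _ _ _ = refl
  degreeBelow-*-monic hs (suc t) (x ∷ q) b (suc i) (s≤s le) =
    degreeBelow-*-monic hs t q
      (degreeBelow-tail hs t x q (degreeBelow-mono ((x ∷ q) *L monic hs) (ℕ.≤-reflexive (ℕ.+-suc _ t)) b)) i le
  degreeBelow-*-monic hs zero    (x ∷ q) b = λ { zero _ → x≈0 ; (suc i) _ → at q≈[] i }
    where
    q≈[] : q ≈ᶜ []
    q≈[] = degreeBelow-0 (degreeBelow-*-monic hs zero q
             (degreeBelow-tail hs zero x q (degreeBelow-mono ((x ∷ q) *L monic hs) (ℕ.n≤1+n _) b)))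
    shifted≈0 : ∀ j → coefficient (0# ∷ q *L monic hs) j ≈ 0#
    shifted≈0 zero    = refl
    shifted≈0 (suc j) = at (*L-cong q≈[] ≈ᶜ-refl) j
    x≈0 : x ≈ 0#
    x≈0 = begin
      x                                            ≈⟨ *-identityʳ x ⟨
      x * 1#                                       ≈⟨ *-cong refl (coefficient-monic-top hs) ⟨
      x * coefficient (monic hs) (length hs)       ≈⟨ +-identityʳ _ ⟨
      x * coefficient (monic hs) (length hs) + 0#  ≈⟨ +-cong refl (shifted≈0 (length hs)) ⟨
      x * coefficient (monic hs) (length hs) + coefficient (0# ∷ q *L monic hs) (length hs)
        ≈⟨ coefficient-*-cons x q (monic hs) (length hs) ⟨
      coefficient ((x ∷ q) *L monic hs) (length hs) ≈⟨ b (length hs) (ℕ.≤-reflexive (ℕ.+-identityʳ _)) ⟩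
      0#                                           ∎

module PolynomialRing {c ℓ} (R : CommutativeRing c ℓ) where
  open Poly R
  private module R = CommutativeRing R

  ≈P-isCommutativeRing : ∀ n → IsCommutativeRing (_≈P_ {n}) _+P_ _*P_ -P_ 0P 1P

  ≈P-commutativeRing : ℕ → CommutativeRing c ℓ
  ≈P-commutativeRing n = record { isCommutativeRing = ≈P-isCommutativeRing n }

  ≈P-isCommutativeRing zero = record
    { isRing = record
      { +-isAbelianGroup = record
        { isGroup = record
          { isMonoid = record
            { isSemigroup = record
              { isMagma = record
                { isEquivalence = record
                  { refl  = λ { {cst a} → R.refl }
                  ; sym   = λ { {cst a} {cst b} → R.sym }
                  ; trans = λ { {cst a} {cst b} {cst d} → R.trans }
                  }
                ; ∙-cong = λ { {cst a} {cst b} {cst d} {cst e} → R.+-cong }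
                }
              ; assoc = λ { (cst a) (cst b) (cst d) → R.+-assoc a b d }
              }
            ; identity = (λ { (cst a) → R.+-identityˡ a }) , (λ { (cst a) → R.+-identityʳ a })
            }
          ; inverse = (λ { (cst a) → R.-‿inverseˡ a }) , (λ { (cst a) → R.-‿inverseʳ a })
          ; ⁻¹-cong = λ { {cst a} {cst b} → R.-‿cong }
          }
        ; comm = λ { (cst a) (cst b) → R.+-comm a b }
        }
      ; *-cong     = λ { {cst a} {cst b} {cst d} {cst e} → R.*-cong }
      ; *-assoc    = λ { (cst a) (cst b) (cst d) → R.*-assoc a b d }
      ; *-identity = (λ { (cst a) → R.*-identityˡ a }) , (λ { (cst a) → R.*-identityʳ a })
      ; distrib    = (λ { (cst a) (cst b) (cst d) → R.distribˡ a b d })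
                   , (λ { (cst a) (cst b) (cst d) → R.distribʳ a b d })
      }
    ; *-comm = λ { (cst a) (cst b) → R.*-comm a b }
    }
  ≈P-isCommutativeRing (suc n) = record
    { isRing = record
      { +-isAbelianGroup = record
        { isGroup = record
          { isMonoid = record
            { isSemigroup = record
              { isMagma = record
                { isEquivalence = record
                  { refl  = λ { {pol a} → L.refl }
                  ; sym   = λ { {pol a} {pol b} → L.sym }
                  ; trans = λ { {pol a} {pol b} {pol d} → L.trans }
                  }
                ; ∙-cong = λ { {pol a} {pol b} {pol d} {pol e} → L.+-cong }
                }
              ; assoc = λ { (pol a) (pol b) (pol d) → L.+-assoc a b d }
              }
            ; identity = (λ { (pol a) → L.+-identityˡ a }) , (λ { (pol a) → L.+-identityʳ a })
            }
          ; inverse = (λ { (pol a) → L.-‿inverseˡ a }) , (λ { (pol a) → L.-‿inverseʳ a })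
          ; ⁻¹-cong = λ { {pol a} {pol b} → L.-‿cong }
          }
        ; comm = λ { (pol a) (pol b) → L.+-comm a b }
        }
      ; *-cong     = λ { {pol a} {pol b} {pol d} {pol e} → L.*-cong }
      ; *-assoc    = λ { (pol a) (pol b) (pol d) → L.*-assoc a b d }
      ; *-identity = (λ { (pol a) → L.*-identityˡ a }) , (λ { (pol a) → L.*-identityʳ a })
      ; distrib    = (λ { (pol a) (pol b) (pol d) → L.distribˡ a b d })
                   , (λ { (pol a) (pol b) (pol d) → L.distribʳ a b d })
      }
    ; *-comm = λ { (pol a) (pol b) → L.*-comm a b }
    }
    where
    module L = IsCommutativeRing (CoefficientList.≋-isCommutativeRing (≈P-commutativeRing n))

  -- _≈P_ computes by matching on both sides, so Agda cannot recover the polynomials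
  -- from an equation; the record wrapper restores inference.
  infix 4 _≃_
  record _≃_ {n} (p q : Poly n) : Set ℓ where
    constructor ⟨_⟩
    field unwrap : p ≈P q
  open _≃_ public

  ≃-isCommutativeRing : ∀ n → IsCommutativeRing (_≃_ {n}) _+P_ _*P_ -P_ 0P 1P
  ≃-isCommutativeRing n = record
    { isRing = record
      { +-isAbelianGroup = record
        { isGroup = record
          { isMonoid = record
            { isSemigroup = record
              { isMagma = record
                { isEquivalence = record
                  { refl  = λ {x} → ⟨ I.refl {x} ⟩
                  ; sym   = λ {x} {y} e → ⟨ I.sym {x} {y} (unwrap e) ⟩
                  ; trans = λ {x} {y} {z} e f → ⟨ I.trans {x} {y} {z} (unwrap e) (unwrap f) ⟩
                  }
                ; ∙-cong = λ {x} {y} {u} {v} e f → ⟨ I.+-cong {x} {y} {u} {v} (unwrap e) (unwrap f) ⟩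
                }
              ; assoc = λ p q r → ⟨ I.+-assoc p q r ⟩
              }
            ; identity = (λ p → ⟨ I.+-identityˡ p ⟩) , (λ p → ⟨ I.+-identityʳ p ⟩)
            }
          ; inverse = (λ p → ⟨ I.-‿inverseˡ p ⟩) , (λ p → ⟨ I.-‿inverseʳ p ⟩)
          ; ⁻¹-cong = λ {x} {y} e → ⟨ I.-‿cong {x} {y} (unwrap e) ⟩
          }
        ; comm = λ p q → ⟨ I.+-comm p q ⟩
        }
      ; *-cong     = λ {x} {y} {u} {v} e f → ⟨ I.*-cong {x} {y} {u} {v} (unwrap e) (unwrap f) ⟩
      ; *-assoc    = λ p q r → ⟨ I.*-assoc p q r ⟩
      ; *-identity = (λ p → ⟨ I.*-identityˡ p ⟩) , (λ p → ⟨ I.*-identityʳ p ⟩)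
      ; distrib    = (λ p q r → ⟨ I.distribˡ p q r ⟩) , (λ p q r → ⟨ I.distribʳ p q r ⟩)
      }
    ; *-comm = λ p q → ⟨ I.*-comm p q ⟩
    }
    where module I = IsCommutativeRing (≈P-isCommutativeRing n)

  polynomialRing : ℕ → CommutativeRing c ℓ
  polynomialRing n = record { isCommutativeRing = ≃-isCommutativeRing n }

-- A ring solver that normalises with the ring itself as coefficient ring cannot see that
-- 1 + (-1) is 0, so here the coefficients are integers, encoded as pairs (m , n) standing for
-- m - n, whose equality is decidable.
module IntegerCoefficientSolver {c ℓ} (A : CommutativeRing c ℓ) where
  open CommutativeRing A hiding (zero)
  open import Algebra.Properties.Semiring.Mult.TCOptimised semiring using (×-homo-+; ×1-homo-*)
    renaming (_×_ to _×′_)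
  open import Algebra.Properties.Ring ring using (-0#≈0#; -‿+-comm; ⁻¹-anti-homo‿-; x[y-z]≈xy-xz; [y-z]x≈yx-zx)
  open import Algebra.Properties.CommutativeSemigroup +-commutativeSemigroup using (interchange)
  open import Relation.Binary.Reasoning.Setoid setoid

  ℤ-rawRing : RawRing 0ℓ 0ℓ
  ℤ-rawRing = record
    { Carrier = ℕ × ℕ
    ; _≈_     = _≡_
    ; _+_     = λ { (m , n) (m′ , n′) → m ℕ.+ m′ , n ℕ.+ n′ }
    ; _*_     = λ { (m , n) (m′ , n′) → m ℕ.* m′ ℕ.+ n ℕ.* n′ , m ℕ.* n′ ℕ.+ n ℕ.* m′ }
    ; -_      = λ { (m , n) → n , m }
    ; 0#      = 0 , 0
    ; 1#      = 1 , 0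
    }

  ι : ℕ → Carrier
  ι n = n ×′ 1#

  difference : ℕ × ℕ → Carrier
  difference (m , n) = ι m - ι n

  -- Agrees with difference, but sends (0 , 0) and (1 , 0) to 0# and 1# on the nose, so that
  -- the constants of an equation evaluate to the intended polynomials definitionally.
  ⟦_⟧ : ℕ × ℕ → Carrier
  ⟦ m , zero  ⟧ = ι m
  ⟦ m , suc n ⟧ = ι m - ι (suc n)

  ⟦⟧≈difference : ∀ p → ⟦ p ⟧ ≈ difference p
  ⟦⟧≈difference (m , zero)  = sym (trans (+-cong refl -0#≈0#) (+-identityʳ _))
  ⟦⟧≈difference (m , suc n) = refl

  ι-+ : ∀ m n → ι (m ℕ.+ n) ≈ ι m + ι n
  ι-+ = ×-homo-+ 1#

  ι-* : ∀ m n → ι (m ℕ.* n) ≈ ι m * ι n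
  ι-* = ×1-homo-*

  -‿distrib-+ : ∀ x y → - (x + y) ≈ - x + - y
  -‿distrib-+ x y = sym (-‿+-comm x y)

  difference-shift : ∀ x y w → (x + w) - (y + w) ≈ x - y
  difference-shift x y w = begin
    (x + w) - (y + w)     ≈⟨ +-cong refl (-‿distrib-+ y w) ⟩
    (x + w) + (- y + - w) ≈⟨ interchange x w (- y) (- w) ⟩
    (x - y) + (w - w)     ≈⟨ +-cong refl (-‿inverseʳ w) ⟩
    (x - y) + 0#          ≈⟨ +-identityʳ _ ⟩
    x - y                 ∎

  difference-+ : ∀ p q → difference (RawRing._+_ ℤ-rawRing p q) ≈ difference p + difference q
  difference-+ (m , n) (m′ , n′) = begin
    ι (m ℕ.+ m′) - ι (n ℕ.+ n′)     ≈⟨ +-cong (ι-+ m m′) (-‿cong (ι-+ n n′)) ⟩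
    (ι m + ι m′) - (ι n + ι n′)     ≈⟨ +-cong refl (-‿distrib-+ _ _) ⟩
    (ι m + ι m′) + (- ι n + - ι n′) ≈⟨ interchange _ _ _ _ ⟩
    (ι m - ι n) + (ι m′ - ι n′)     ∎

  difference-* : ∀ p q → difference (RawRing._*_ ℤ-rawRing p q) ≈ difference p * difference q
  difference-* (m , n) (m′ , n′) = begin
    ι (m ℕ.* m′ ℕ.+ n ℕ.* n′) - ι (m ℕ.* n′ ℕ.+ n ℕ.* m′)
      ≈⟨ +-cong (trans (ι-+ (m ℕ.* m′) (n ℕ.* n′)) (+-cong (ι-* m m′) (ι-* n n′)))
                (-‿cong (trans (ι-+ (m ℕ.* n′) (n ℕ.* m′)) (+-cong (ι-* m n′) (ι-* n m′)))) ⟩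
    (a * a′ + b * b′) - (a * b′ + b * a′)
      ≈⟨ +-cong refl (trans (-‿distrib-+ _ _) (+-comm _ _)) ⟩
    (a * a′ + b * b′) + (- (b * a′) + - (a * b′))
      ≈⟨ interchange _ _ _ _ ⟩
    (a * a′ - b * a′) + (b * b′ - a * b′)
      ≈⟨ +-cong refl (sym (⁻¹-anti-homo‿- _ _)) ⟩
    (a * a′ - b * a′) - (a * b′ - b * b′)
      ≈⟨ +-cong ([y-z]x≈yx-zx a′ a b) (-‿cong ([y-z]x≈yx-zx b′ a b)) ⟨
    (a - b) * a′ - (a - b) * b′
      ≈⟨ x[y-z]≈xy-xz (a - b) a′ b′ ⟨
    (a - b) * (a′ - b′) ∎
    where a = ι m; b = ι n; a′ = ι m′; b′ = ι n′

  homomorphism : ℤ-rawRing -Raw-AlmostCommutative⟶ fromCommutativeRing A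
  homomorphism = record
    { ⟦_⟧    = ⟦_⟧
    ; +-homo = λ p q → trans (⟦⟧≈difference (RawRing._+_ ℤ-rawRing p q))
                 (trans (difference-+ p q) (sym (+-cong (⟦⟧≈difference p) (⟦⟧≈difference q))))
    ; *-homo = λ p q → trans (⟦⟧≈difference (RawRing._*_ ℤ-rawRing p q))
                 (trans (difference-* p q) (sym (*-cong (⟦⟧≈difference p) (⟦⟧≈difference q))))
    ; -‿homo = λ { (m , n) → trans (⟦⟧≈difference (n , m))
                 (trans (sym (⁻¹-anti-homo‿- (ι m) (ι n))) (-‿cong (sym (⟦⟧≈difference (m , n))))) }
    ; 0-homo = refl
    ; 1-homo = refl
    }

  equal? : ∀ p q → Maybe (⟦ p ⟧ ≈ ⟦ q ⟧)
  equal? (m , n) (m′ , n′) with m ℕ.+ n′ ℕ.≟ m′ ℕ.+ n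
  ... | no  _ = nothing
  ... | yes e = just (trans (⟦⟧≈difference (m , n)) (trans (begin
    ι m - ι n                    ≈⟨ difference-shift (ι m) (ι n) (ι n′) ⟨
    (ι m + ι n′) - (ι n + ι n′)  ≈⟨ +-cong (trans (sym (ι-+ m n′)) (trans (reflexive (≡.cong ι e)) (ι-+ m′ n)))
                                           (-‿cong (+-comm _ _)) ⟩
    (ι m′ + ι n) - (ι n′ + ι n)  ≈⟨ difference-shift (ι m′) (ι n′) (ι n) ⟩
    ι m′ - ι n′                  ∎) (sym (⟦⟧≈difference (m′ , n′)))))

  open Algebra.Solver.Ring ℤ-rawRing (fromCommutativeRing A) homomorphism equal? public
    using (solve; _:=_; _:+_; _:*_; _:-_; :-_; con)

module Multivariate {c ℓ} (R : CommutativeRing c ℓ) where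
  open Poly R
  open PolynomialRing R
  private module R = CommutativeRing R

  module P {n : ℕ} = CommutativeRing (polynomialRing n)
  open P using (+-cong; *-cong; -‿cong; +-comm; *-assoc; *-comm; +-identityˡ; +-identityʳ;
                *-identityˡ; *-identityʳ; zeroˡ; zeroʳ)
     renaming (refl to ≃-refl; sym to ≃-sym; trans to ≃-trans; reflexive to ≃-reflexive)
  module ≃-Reasoning {n : ℕ} = Relation.Binary.Reasoning.Setoid (P.setoid {n})
  module L {n : ℕ} = CoefficientList (polynomialRing n)
  module RP {n : ℕ} = Algebra.Properties.Ring (P.ring {n})

  module Solver {n : ℕ} = IntegerCoefficientSolver (polynomialRing n)
  open Solver using (_:=_; _:+_; _:*_; _:-_; :-_; con)

  +-congˡ : ∀ {n} (a : Poly n) {u v} → u ≃ v → a +P u ≃ a +P v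
  +-congˡ a = +-cong (≃-refl {x = a})
  +-congʳ : ∀ {n} {u v : Poly n} → u ≃ v → (b : Poly n) → u +P b ≃ v +P b
  +-congʳ e b = +-cong e (≃-refl {x = b})
  *-congˡ : ∀ {n} (a : Poly n) {u v} → u ≃ v → a *P u ≃ a *P v
  *-congˡ a = *-cong (≃-refl {x = a})
  *-congʳ : ∀ {n} {u v : Poly n} → u ≃ v → (b : Poly n) → u *P b ≃ v *P b
  *-congʳ e b = *-cong e (≃-refl {x = b})

  -- Constants and substitution

  wrap-eqL : ∀ {n} (p q : List (Poly n)) → eqL (_≈P 0P) _≈P_ p q → L._≋_ p q
  wrap-eqL []      []      _         = tt
  wrap-eqL []      (y ∷ q) (y≈0 , e) = ⟨ y≈0 ⟩ , wrap-eqL [] q e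
  wrap-eqL (x ∷ p) []      (x≈0 , e) = ⟨ x≈0 ⟩ , wrap-eqL p [] e
  wrap-eqL (x ∷ p) (y ∷ q) (x≈y , e) = ⟨ x≈y ⟩ , wrap-eqL p q e

  unwrap-eqL : ∀ {n} (p q : List (Poly n)) → L._≋_ p q → eqL (_≈P 0P) _≈P_ p q
  unwrap-eqL []      []      _         = tt
  unwrap-eqL []      (y ∷ q) (y≈0 , e) = unwrap y≈0 , unwrap-eqL [] q e
  unwrap-eqL (x ∷ p) []      (x≈0 , e) = unwrap x≈0 , unwrap-eqL p [] e
  unwrap-eqL (x ∷ p) (y ∷ q) (x≈y , e) = unwrap x≈y , unwrap-eqL p q e

  pol-cong : ∀ {n} {p q : List (Poly n)} → L._≈ᶜ_ p q → pol p ≃ pol q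
  pol-cong {p = p} {q} e = ⟨ unwrap-eqL p q (L.≈ᶜ⇒≋ p q e) ⟩

  pol-injective : ∀ {n} {p q : List (Poly n)} → pol p ≃ pol q → L._≈ᶜ_ p q
  pol-injective {p = p} {q} e = L.≋⇒≈ᶜ p q (wrap-eqL p q (unwrap e))

  X₀ : ∀ {n} → Poly (suc n)
  X₀ = var zero

  lift : ∀ {n} → Poly n → Poly (suc n)
  lift a = pol (a ∷ [])

  lift-cong : ∀ {n} {a b : Poly n} → a ≃ b → lift a ≃ lift b
  lift-cong e = ⟨ unwrap e , tt ⟩

  lift-* : ∀ {n} (a b : Poly n) → lift (a *P b) ≃ lift a *P lift b
  lift-* a b = pol-cong (L.∷-cong (≃-sym (+-identityʳ _)) L.≈ᶜ-refl)

  lift-0 : ∀ {n} → lift (0P {n}) ≃ 0P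
  lift-0 = pol-cong (L.coefficientwise λ { zero → ≃-refl ; (suc i) → ≃-refl })

  X₀*pol : ∀ {n} (p : List (Poly n)) → X₀ *P pol p ≃ pol (0P ∷ p)
  X₀*pol p = pol-cong (L.coefficientwise λ i →
    ≃-trans (L.coefficient-*-cons 0P (1P ∷ []) p i)
            (≃-trans (+-cong (zeroˡ _) ≃-refl) (≃-trans (+-identityˡ _) (L.at (L.∷-cong ≃-refl (L.*L-identityˡ p)) i))))

  pol-∷ : ∀ {n} (a : Poly n) (p : List (Poly n)) → pol (a ∷ p) ≃ lift a +P X₀ *P pol p
  pol-∷ a p = ≃-sym (≃-trans (+-congˡ (lift a) (X₀*pol p)) (pol-cong (L.∷-cong (+-identityʳ a) L.≈ᶜ-refl)))

  constP-+ : ∀ {n} a b → constP {n} (a R.+ b) ≃ constP a +P constP b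
  constP-+ {zero}  a b = ≃-refl
  constP-+ {suc n} a b = lift-cong (constP-+ a b)

  constP-* : ∀ {n} a b → constP {n} (a R.* b) ≃ constP a *P constP b
  constP-* {zero}  a b = ≃-refl
  constP-* {suc n} a b = ≃-trans (lift-cong (constP-* a b)) (lift-* _ _)

  constP-neg : ∀ {n} a → constP {n} (R.- a) ≃ -P constP a
  constP-neg {zero}  a = ≃-refl
  constP-neg {suc n} a = lift-cong (constP-neg a)

  constP-0 : ∀ {n} → constP {n} R.0# ≃ 0P
  constP-0 {zero}  = ≃-refl
  constP-0 {suc n} = ≃-trans (lift-cong constP-0) lift-0

  constP-1 : ∀ {n} → constP {n} R.1# ≃ 1P
  constP-1 {zero}  = ≃-refl
  constP-1 {suc n} = lift-cong constP-1

  constP-cong : ∀ {n} {a b} → a R.≈ b → constP {n} a ≃ constP b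
  constP-cong {zero}  e = ⟨ e ⟩
  constP-cong {suc n} e = lift-cong (constP-cong e)

  substP-0 : ∀ {n k} (ρ : Fin n → Poly k) → substP ρ 0P ≃ 0P
  substP-0 {zero}  ρ = constP-0
  substP-0 {suc n} ρ = ≃-refl

  substP-constP : ∀ {n k} (ρ : Fin n → Poly k) a → substP ρ (constP a) ≃ constP a
  substP-constP {zero}  ρ a = ≃-refl
  substP-constP {suc n} ρ a = ≃-trans (+-cong (substP-constP (λ i → ρ (suc i)) a) (zeroʳ _)) (+-identityʳ _)

  substP-1 : ∀ {n k} (ρ : Fin n → Poly k) → substP ρ 1P ≃ 1P
  substP-1 {zero}  ρ = constP-1
  substP-1 {suc n} ρ = ≃-trans (+-cong (substP-1 (λ i → ρ (suc i))) (zeroʳ _)) (+-identityʳ _)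

  substP-ext : ∀ {n k} {ρ σ : Fin n → Poly k} → (∀ i → ρ i ≃ σ i) → ∀ p → substP ρ p ≃ substP σ p
  substP-ext-pol : ∀ {n k} {ρ σ : Fin (suc n) → Poly k} → (∀ i → ρ i ≃ σ i) →
                   ∀ p → substP ρ (pol p) ≃ substP σ (pol p)
  substP-ext e (cst a) = ≃-refl
  substP-ext e (pol p) = substP-ext-pol e p
  substP-ext-pol e []      = ≃-refl
  substP-ext-pol e (x ∷ p) = +-cong (substP-ext (λ i → e (suc i)) x) (*-cong (e zero) (substP-ext-pol e p))

  substP-cong : ∀ {n k} (ρ : Fin n → Poly k) {p q : Poly n} → p ≃ q → substP ρ p ≃ substP ρ q
  substP-cong-pol : ∀ {n k} (ρ : Fin (suc n) → Poly k) (p q : List (Poly n)) →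
                    L._≋_ p q → substP ρ (pol p) ≃ substP ρ (pol q)
  substP-cong ρ {cst a} {cst b} e = constP-cong (unwrap e)
  substP-cong ρ {pol p} {pol q} e = substP-cong-pol ρ p q (wrap-eqL p q (unwrap e))
  substP-cong-pol ρ []      []      _         = ≃-refl
  substP-cong-pol ρ []      (y ∷ q) (y≈0 , e) = ≃-sym
    (≃-trans (+-cong (≃-trans (substP-cong (λ i → ρ (suc i)) y≈0) (substP-0 (λ i → ρ (suc i))))
                     (*-congˡ (ρ zero) (≃-sym (substP-cong-pol ρ [] q e))))
             (≃-trans (+-identityˡ _) (zeroʳ _)))
  substP-cong-pol ρ (x ∷ p) []      (x≈0 , e) =
    ≃-trans (+-cong (≃-trans (substP-cong (λ i → ρ (suc i)) x≈0) (substP-0 (λ i → ρ (suc i))))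
                    (*-congˡ (ρ zero) (substP-cong-pol ρ p [] e)))
            (≃-trans (+-identityˡ _) (zeroʳ _))
  substP-cong-pol ρ (x ∷ p) (y ∷ q) (x≈y , e) =
    +-cong (substP-cong (λ i → ρ (suc i)) x≈y) (*-congˡ (ρ zero) (substP-cong-pol ρ p q e))

  module _ {k : ℕ} where
    open Solver {k} using (solve)

    horner-step-+ : ∀ (a b r p q : Poly k) → (a +P b) +P r *P (p +P q) ≃ (a +P r *P p) +P (b +P r *P q)
    horner-step-+ = solve 5 (λ a b r p q → (a :+ b) :+ r :* (p :+ q) := (a :+ r :* p) :+ (b :+ r :* q)) ≃-refl

    horner-step-neg : ∀ (a r p : Poly k) → -P a +P r *P (-P p) ≃ -P (a +P r *P p)
    horner-step-neg = solve 3 (λ a r p → (:- a) :+ r :* (:- p) := :- (a :+ r :* p)) ≃-refl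

    horner-step-*ʳ : ∀ (a q r p : Poly k) → a *P q +P r *P (p *P q) ≃ (a +P r *P p) *P q
    horner-step-*ʳ = solve 4 (λ a q r p → a :* q :+ r :* (p :* q) := (a :+ r :* p) :* q) ≃-refl

    horner-step-*ˡ : ∀ (a b r q : Poly k) → a *P b +P r *P (a *P q) ≃ a *P (b +P r *P q)
    horner-step-*ˡ = solve 4 (λ a b r q → a :* b :+ r :* (a :* q) := a :* (b :+ r :* q)) ≃-refl

  substP-+ : ∀ {n k} (ρ : Fin n → Poly k) p q → substP ρ (p +P q) ≃ substP ρ p +P substP ρ q
  substP-+-pol : ∀ {n k} (ρ : Fin (suc n) → Poly k) (p q : List (Poly n)) →
                 substP ρ (pol p +P pol q) ≃ substP ρ (pol p) +P substP ρ (pol q)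
  substP-+ ρ (cst a) (cst b) = constP-+ a b
  substP-+ ρ (pol p) (pol q) = substP-+-pol ρ p q
  substP-+-pol ρ []      q       = ≃-sym (+-identityˡ _)
  substP-+-pol ρ (x ∷ p) []      = ≃-sym (+-identityʳ _)
  substP-+-pol ρ (x ∷ p) (y ∷ q) =
    ≃-trans (+-cong (substP-+ (λ i → ρ (suc i)) x y) (*-congˡ (ρ zero) (substP-+-pol ρ p q))) (horner-step-+ _ _ _ _ _)

  substP-neg : ∀ {n k} (ρ : Fin n → Poly k) p → substP ρ (-P p) ≃ -P substP ρ p
  substP-neg-pol : ∀ {n k} (ρ : Fin (suc n) → Poly k) (p : List (Poly n)) →
                   substP ρ (-P pol p) ≃ -P substP ρ (pol p)
  substP-neg ρ (cst a) = constP-neg a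
  substP-neg ρ (pol p) = substP-neg-pol ρ p
  substP-neg-pol ρ []      = ≃-sym RP.-0#≈0#
  substP-neg-pol ρ (x ∷ p) =
    ≃-trans (+-cong (substP-neg (λ i → ρ (suc i)) x) (*-congˡ (ρ zero) (substP-neg-pol ρ p))) (horner-step-neg _ _ _)

  substP-- : ∀ {n k} (ρ : Fin n → Poly k) p q → substP ρ (p -P q) ≃ substP ρ p -P substP ρ q
  substP-- ρ p q = ≃-trans (substP-+ ρ p (-P q)) (+-congˡ (substP ρ p) (substP-neg ρ q))

  substP-* : ∀ {n k} (ρ : Fin n → Poly k) p q → substP ρ (p *P q) ≃ substP ρ p *P substP ρ q
  substP-*-pol : ∀ {n k} (ρ : Fin (suc n) → Poly k) (p q : List (Poly n)) →
                 substP ρ (pol p *P pol q) ≃ substP ρ (pol p) *P substP ρ (pol q)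
  substP-scale : ∀ {n k} (ρ : Fin (suc n) → Poly k) (x : Poly n) (q : List (Poly n)) →
                 substP ρ (pol (map (x *P_) q)) ≃ substP (λ i → ρ (suc i)) x *P substP ρ (pol q)
  substP-* ρ (cst a) (cst b) = constP-* a b
  substP-* ρ (pol p) (pol q) = substP-*-pol ρ p q
  substP-*-pol ρ []      q = ≃-sym (zeroˡ _)
  substP-*-pol ρ (x ∷ p) q = begin
    substP ρ (pol (map (x *P_) q) +P pol (0P ∷ mulL 0P _+P_ _*P_ p q))
      ≈⟨ substP-+-pol ρ (map (x *P_) q) (0P ∷ mulL 0P _+P_ _*P_ p q) ⟩
    substP ρ (pol (map (x *P_) q)) +P (substP ρ′ 0P +P ρ zero *P substP ρ (pol p *P pol q))
      ≈⟨ +-cong (substP-scale ρ x q)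
                (≃-trans (+-congʳ (substP-0 ρ′) _) (≃-trans (+-identityˡ _) (*-congˡ (ρ zero) (substP-*-pol ρ p q)))) ⟩
    substP ρ′ x *P substP ρ (pol q) +P ρ zero *P (substP ρ (pol p) *P substP ρ (pol q))
      ≈⟨ horner-step-*ʳ _ _ _ _ ⟩
    (substP ρ′ x +P ρ zero *P substP ρ (pol p)) *P substP ρ (pol q) ∎
    where
    open ≃-Reasoning
    ρ′ = λ i → ρ (suc i)
  substP-scale ρ x []      = ≃-sym (zeroʳ _)
  substP-scale ρ x (y ∷ q) =
    ≃-trans (+-cong (substP-* (λ i → ρ (suc i)) x y) (*-congˡ (ρ zero) (substP-scale ρ x q))) (horner-step-*ˡ _ _ _ _)

  substP-var : ∀ {n k} (ρ : Fin n → Poly k) i → substP ρ (var i) ≃ ρ i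
  substP-var {suc n} ρ zero = begin
    substP ρ′ 0P +P ρ zero *P (substP ρ′ 1P +P ρ zero *P 0P)
      ≈⟨ +-cong (substP-0 ρ′) (*-congˡ (ρ zero) (+-cong (substP-1 ρ′) (zeroʳ _))) ⟩
    0P +P ρ zero *P (1P +P 0P)
      ≈⟨ Solver.solve 1 (λ r → con (0 , 0) :+ r :* (con (1 , 0) :+ con (0 , 0)) := r) ≃-refl (ρ zero) ⟩
    ρ zero ∎
    where
    open ≃-Reasoning
    ρ′ = λ i → ρ (suc i)
  substP-var {suc n} ρ (suc i) = ≃-trans (+-cong (substP-var (λ i → ρ (suc i)) i) (zeroʳ _)) (+-identityʳ _)

  substP-∘ : ∀ {n k j} (σ : Fin k → Poly j) (ρ : Fin n → Poly k) p →
             substP σ (substP ρ p) ≃ substP (λ i → substP σ (ρ i)) p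
  substP-∘-pol : ∀ {n k j} (σ : Fin k → Poly j) (ρ : Fin (suc n) → Poly k) (p : List (Poly n)) →
                 substP σ (substP ρ (pol p)) ≃ substP (λ i → substP σ (ρ i)) (pol p)
  substP-∘ σ ρ (cst a) = substP-constP σ a
  substP-∘ σ ρ (pol p) = substP-∘-pol σ ρ p
  substP-∘-pol σ ρ []      = substP-0 σ
  substP-∘-pol σ ρ (x ∷ p) = ≃-trans (substP-+ σ (substP (λ i → ρ (suc i)) x) (ρ zero *P substP ρ (pol p)))
    (+-cong (substP-∘ σ (λ i → ρ (suc i)) x)
            (≃-trans (substP-* σ (ρ zero) (substP ρ (pol p))) (*-congˡ (substP σ (ρ zero)) (substP-∘-pol σ ρ p))))

  substP-lift : ∀ {n k} (ρ : Fin n → Poly k) p → substP (λ i → lift (ρ i)) p ≃ lift (substP ρ p)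
  substP-lift-pol : ∀ {n k} (ρ : Fin (suc n) → Poly k) (p : List (Poly n)) →
                    substP (λ i → lift (ρ i)) (pol p) ≃ lift (substP ρ (pol p))
  substP-lift ρ (cst a) = ≃-refl
  substP-lift ρ (pol p) = substP-lift-pol ρ p
  substP-lift-pol ρ []      = ≃-sym lift-0
  substP-lift-pol ρ (x ∷ p) = +-cong (substP-lift (λ i → ρ (suc i)) x)
    (≃-trans (*-congˡ (lift (ρ zero)) (substP-lift-pol ρ p)) (≃-sym (lift-* _ _)))

  substP-var-id : ∀ {n} (p : Poly n) → substP var p ≃ p
  substP-var-id-pol : ∀ {n} (p : List (Poly n)) → substP var (pol p) ≃ pol p
  substP-var-id (cst a) = ≃-refl
  substP-var-id (pol p) = substP-var-id-pol p
  substP-var-id-pol []      = ≃-refl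
  substP-var-id-pol (x ∷ p) = ≃-trans
    (+-cong (≃-trans (substP-lift var x) (lift-cong (substP-var-id x))) (*-congˡ X₀ (substP-var-id-pol p)))
    (≃-sym (pol-∷ x p))

  -- Congruences

  infix 4 _≃_mod_
  record _≃_mod_ {n} (a b d : Poly n) : Set (c ⊔ ℓ) where
    constructor via
    field
      quotient   : Poly n
      ≃-quotient : a ≃ b +P d *P quotient
  open _≃_mod_ public

  module _ {n : ℕ} where
    open Solver {n} using (solve)

    ≃⇒≃mod : ∀ {d a b : Poly n} → a ≃ b → a ≃ b mod d
    ≃⇒≃mod {d} {a} {b} e = via 0P (≃-trans e (≃-sym (≃-trans (+-congˡ b (zeroʳ d)) (+-identityʳ b))))

    mod-refl : ∀ {d a : Poly n} → a ≃ a mod d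
    mod-refl = ≃⇒≃mod ≃-refl

    mod-sym : ∀ {d a b : Poly n} → a ≃ b mod d → b ≃ a mod d
    mod-sym {d} {a} {b} (via q e) = via (-P q) (begin
      b                            ≈⟨ solve 3 (λ b d q → b := (b :+ d :* q) :+ d :* (:- q)) ≃-refl b d q ⟩
      (b +P d *P q) +P d *P (-P q) ≈⟨ +-congʳ (≃-sym e) _ ⟩
      a +P d *P (-P q)             ∎)
      where open ≃-Reasoning

    mod-trans : ∀ {d a b e : Poly n} → a ≃ b mod d → b ≃ e mod d → a ≃ e mod d
    mod-trans {d} {a} {b} {e} (via q a≃) (via q′ b≃) = via (q′ +P q) (begin
      a                              ≈⟨ a≃ ⟩
      b +P d *P q                    ≈⟨ +-congʳ b≃ _ ⟩
      (e +P d *P q′) +P d *P q       ≈⟨ solve 4 (λ e d q q′ → (e :+ d :* q′) :+ d :* q := e :+ d :* (q′ :+ q)) ≃-refl e d q q′ ⟩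
      e +P d *P (q′ +P q)            ∎)
      where open ≃-Reasoning

    mod-+ : ∀ {d a b a′ b′ : Poly n} → a ≃ b mod d → a′ ≃ b′ mod d → a +P a′ ≃ b +P b′ mod d
    mod-+ {d} {a} {b} {a′} {b′} (via q e) (via q′ e′) = via (q +P q′) (≃-trans (+-cong e e′)
      (solve 5 (λ b b′ d q q′ → (b :+ d :* q) :+ (b′ :+ d :* q′) := (b :+ b′) :+ d :* (q :+ q′)) ≃-refl b b′ d q q′))

    mod-* : ∀ {d a b a′ b′ : Poly n} → a ≃ b mod d → a′ ≃ b′ mod d → a *P a′ ≃ b *P b′ mod d
    mod-* {d} {a} {b} {a′} {b′} (via q e) (via q′ e′) = via (b *P q′ +P q *P b′ +P d *P q *P q′) (≃-trans (*-cong e e′)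
      (solve 5 (λ b b′ d q q′ → (b :+ d :* q) :* (b′ :+ d :* q′) := b :* b′ :+ d :* (b :* q′ :+ q :* b′ :+ d :* q :* q′))
             ≃-refl b b′ d q q′))

    mod-*ˡ : ∀ {d a b : Poly n} (e : Poly n) → a ≃ b mod d → e *P a ≃ e *P b mod d
    mod-*ˡ e = mod-* (mod-refl {a = e})

    mod-scale : ∀ {d a b : Poly n} (e : Poly n) → a ≃ b mod d → e *P a ≃ e *P b mod e *P d
    mod-scale {d} {a} {b} e (via q a≃) = via q (≃-trans (*-congˡ e a≃)
      (solve 4 (λ e b d q → e :* (b :+ d :* q) := e :* b :+ (e :* d) :* q) ≃-refl e b d q))

    mod-cong : ∀ {d d′ a a′ b b′ : Poly n} → a ≃ a′ → b ≃ b′ → d ≃ d′ → a ≃ b mod d → a′ ≃ b′ mod d′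
    mod-cong a≃ b≃ d≃ (via q e) = via q (≃-trans (≃-sym a≃) (≃-trans e (+-cong b≃ (*-congʳ d≃ q))))

    mod-1 : ∀ (a b : Poly n) → a ≃ b mod 1P
    mod-1 a b = via (a -P b) (solve 2 (λ a b → a := b :+ con (1 , 0) :* (a :- b)) ≃-refl a b)

    mod-difference : ∀ {d a b : Poly n} → (a≃b : a ≃ b mod d) → a -P b ≃ d *P quotient a≃b
    mod-difference {d} {a} {b} (via q e) = ≃-trans (+-congʳ e (-P b)) (solve 3 (λ b d q → (b :+ d :* q) :- b := d :* q) ≃-refl b d q)

  mod-substP : ∀ {n k} (ρ : Fin n → Poly k) {d a b : Poly n} →
               a ≃ b mod d → substP ρ a ≃ substP ρ b mod substP ρ d
  mod-substP ρ {d} {a} {b} (via q e) =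
    via (substP ρ q) (≃-trans (substP-cong ρ e) (≃-trans (substP-+ ρ b (d *P q)) (+-congˡ _ (substP-* ρ d q))))

  substP-mod : ∀ {n k} {d : Poly k} {ρ σ : Fin n → Poly k} →
               (∀ i → ρ i ≃ σ i mod d) → ∀ p → substP ρ p ≃ substP σ p mod d
  substP-mod-pol : ∀ {n k} {d : Poly k} {ρ σ : Fin (suc n) → Poly k} →
                   (∀ i → ρ i ≃ σ i mod d) → ∀ p → substP ρ (pol p) ≃ substP σ (pol p) mod d
  substP-mod e (cst a) = mod-refl
  substP-mod e (pol p) = substP-mod-pol e p
  substP-mod-pol e []      = mod-refl
  substP-mod-pol e (x ∷ p) = mod-+ (substP-mod (λ i → e (suc i)) x) (mod-* (e zero) (substP-mod-pol e p))

  -- Renaming and reduced polynomials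

  rename : ∀ {a b} → (Fin a → Fin b) → Poly a → Poly b
  rename θ = substP (λ i → var (θ i))

  weakenAt : ∀ {n} → Fin (suc n) → Poly n → Poly (suc n)
  weakenAt v = rename (punchIn v)

  substP-rename : ∀ {a b k} (σ : Fin b → Poly k) (θ : Fin a → Fin b) p →
                  substP σ (rename θ p) ≃ substP (λ i → σ (θ i)) p
  substP-rename σ θ p = ≃-trans (substP-∘ σ (λ i → var (θ i)) p) (substP-ext (λ i → substP-var σ (θ i)) p)

  rename-∘ : ∀ {a b k} (φ : Fin b → Fin k) (θ : Fin a → Fin b) p → rename φ (rename θ p) ≃ rename (λ i → φ (θ i)) p
  rename-∘ φ θ = substP-rename (λ i → var (φ i)) θ

  rename-ext : ∀ {a b} {θ φ : Fin a → Fin b} → (∀ i → θ i ≡ φ i) → ∀ p → rename θ p ≃ rename φ p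
  rename-ext e = substP-ext (λ i → ≃-reflexive (≡.cong var (e i)))

  rename-id : ∀ {n} {θ : Fin n → Fin n} → (∀ i → θ i ≡ i) → ∀ p → rename θ p ≃ p
  rename-id e p = ≃-trans (rename-ext e p) (substP-var-id p)

  rename-var-var : ∀ {a b} (θ : Fin a → Fin b) x y → rename θ (var x -P var y) ≃ var (θ x) -P var (θ y)
  rename-var-var θ x y = ≃-trans (substP-- (λ i → var (θ i)) (var x) (var y))
                                 (+-cong (substP-var (λ i → var (θ i)) x) (-‿cong (substP-var (λ i → var (θ i)) y)))

  rename-var-constP : ∀ {a b} (θ : Fin a → Fin b) x z → rename θ (var x -P constP z) ≃ var (θ x) -P constP z
  rename-var-constP θ x z = ≃-trans (substP-- (λ i → var (θ i)) (var x) (constP z))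
                                    (+-cong (substP-var (λ i → var (θ i)) x) (-‿cong (substP-constP (λ i → var (θ i)) z)))

  horner : ∀ {n} → Fin (suc n) → (ℕ → Poly n) → ℕ → Poly (suc n)
  horner v f zero    = 0P
  horner v f (suc m) = weakenAt v (f 0) +P var v *P horner v (λ k → f (suc k)) m

  -- P = Σ_{k<m} c_k X_v^k with every c_k free of X_v, i.e. deg_{X_v} P < m.
  record Reduced {n} (v : Fin (suc n)) (m : ℕ) (P : Poly (suc n)) : Set (c ⊔ ℓ) where
    constructor reduced
    field
      coeffs   : ℕ → Poly n
      ≃-horner : P ≃ horner v coeffs m
  open Reduced public

  horner-0 : ∀ {n} (v : Fin (suc n)) m → horner v (λ _ → 0P) m ≃ 0P
  horner-0 v zero    = ≃-refl
  horner-0 v (suc m) = ≃-trans (+-cong (substP-0 (λ i → var (punchIn v i))) (≃-trans (*-congˡ (var v) (horner-0 v m)) (zeroʳ _)))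
                               (+-identityʳ _)

  horner-+ : ∀ {n} (v : Fin (suc n)) f g m → horner v (λ k → f k +P g k) m ≃ horner v f m +P horner v g m
  horner-+ v f g zero    = ≃-sym (+-identityʳ _)
  horner-+ v f g (suc m) = ≃-trans (+-cong (substP-+ _ (f 0) (g 0)) (*-congˡ (var v) (horner-+ v (λ k → f (suc k)) (λ k → g (suc k)) m)))
                                   (horner-step-+ _ _ _ _ _)

  horner-neg : ∀ {n} (v : Fin (suc n)) f m → horner v (λ k → -P f k) m ≃ -P horner v f m
  horner-neg v f zero    = ≃-sym RP.-0#≈0#
  horner-neg v f (suc m) = ≃-trans (+-cong (substP-neg _ (f 0)) (*-congˡ (var v) (horner-neg v (λ k → f (suc k)) m)))
                                   (horner-step-neg _ _ _)

  horner-* : ∀ {n} (v : Fin (suc n)) a f m → horner v (λ k → a *P f k) m ≃ weakenAt v a *P horner v f m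
  horner-* v a f zero    = ≃-sym (zeroʳ _)
  horner-* v a f (suc m) = ≃-trans (+-cong (substP-* _ a (f 0)) (*-congˡ (var v) (horner-* v a (λ k → f (suc k)) m)))
                                   (horner-step-*ˡ _ _ _ _)

  truncate : ∀ {n} → (ℕ → Poly n) → ℕ → ℕ → Poly n
  truncate f zero    k       = 0P
  truncate f (suc m) zero    = f 0
  truncate f (suc m) (suc k) = truncate (λ j → f (suc j)) m k

  horner-truncate : ∀ {n} (v : Fin (suc n)) f {m m′} → m ≤ m′ → horner v f m ≃ horner v (truncate f m) m′
  horner-truncate v f {zero}  {m′}    _         = ≃-sym (horner-0 v m′)
  horner-truncate v f {suc m} {suc m′} (s≤s le) = +-congˡ _ (*-congˡ (var v) (horner-truncate v (λ k → f (suc k)) le))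

  horner-rename : ∀ {a b} (θ : Fin (suc a) → Fin (suc b)) (θ′ : Fin a → Fin b) {v w} → θ v ≡ w →
                  (∀ j → θ (punchIn v j) ≡ punchIn w (θ′ j)) →
                  ∀ f m → rename θ (horner v f m) ≃ horner w (λ k → rename θ′ (f k)) m
  horner-rename θ θ′ θv≡w θ∘punchIn f zero    = substP-0 (λ i → var (θ i))
  horner-rename θ θ′ {v} {w} θv≡w θ∘punchIn f (suc m) = ≃-trans (substP-+ _ (weakenAt v (f 0)) _)
    (+-cong (≃-trans (rename-∘ θ (punchIn v) (f 0)) (≃-trans (rename-ext θ∘punchIn (f 0)) (≃-sym (rename-∘ (punchIn w) θ′ (f 0)))))
            (≃-trans (substP-* _ (var v) _)
                     (*-cong (≃-trans (substP-var _ v) (≃-reflexive (≡.cong var θv≡w)))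
                             (horner-rename θ θ′ θv≡w θ∘punchIn (λ k → f (suc k)) m))))

  module _ {n : ℕ} {v : Fin (suc n)} where

    reduced-cong : ∀ {m P Q} → P ≃ Q → Reduced v m P → Reduced v m Q
    reduced-cong P≃Q (reduced f e) = reduced f (≃-trans (≃-sym P≃Q) e)

    reduced-0 : ∀ {m} → Reduced v m 0P
    reduced-0 {m} = reduced (λ _ → 0P) (≃-sym (horner-0 v m))

    reduced-+ : ∀ {m P Q} → Reduced v m P → Reduced v m Q → Reduced v m (P +P Q)
    reduced-+ {m} (reduced f e) (reduced g e′) = reduced (λ k → f k +P g k) (≃-trans (+-cong e e′) (≃-sym (horner-+ v f g m)))

    reduced-neg : ∀ {m P} → Reduced v m P → Reduced v m (-P P)
    reduced-neg {m} (reduced f e) = reduced (λ k → -P f k) (≃-trans (-‿cong e) (≃-sym (horner-neg v f m)))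

    reduced-− : ∀ {m P Q} → Reduced v m P → Reduced v m Q → Reduced v m (P -P Q)
    reduced-− rP rQ = reduced-+ rP (reduced-neg rQ)

    reduced-* : ∀ {m P} a → Reduced v m P → Reduced v m (weakenAt v a *P P)
    reduced-* {m} a (reduced f e) = reduced (λ k → a *P f k) (≃-trans (*-congˡ _ e) (≃-sym (horner-* v a f m)))

    reduced-mono : ∀ {m m′ P} → m ≤ m′ → Reduced v m P → Reduced v m′ P
    reduced-mono {m} le (reduced f e) = reduced (truncate f m) (≃-trans e (horner-truncate v f le))

    reduced-var* : ∀ {m P} → Reduced v m P → Reduced v (suc m) (var v *P P)
    reduced-var* (reduced f e) = reduced (λ { zero → 0P ; (suc k) → f k })
      (≃-sym (≃-trans (+-cong (substP-0 (λ i → var (punchIn v i))) (*-congˡ (var v) (≃-sym e))) (+-identityˡ _)))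

    reduced-weakenAt : ∀ a → Reduced v 1 (weakenAt v a)
    reduced-weakenAt a = reduced (λ _ → a) (≃-sym (≃-trans (+-congˡ _ (zeroʳ _)) (+-identityʳ _)))

  reduced-rename : ∀ {a b} (θ : Fin (suc a) → Fin (suc b)) (θ′ : Fin a → Fin b) {v w} → θ v ≡ w →
                   (∀ j → θ (punchIn v j) ≡ punchIn w (θ′ j)) → ∀ {m P} → Reduced v m P → Reduced w m (rename θ P)
  reduced-rename θ θ′ θv≡w θ∘punchIn {m} (reduced f e) =
    reduced (λ k → rename θ′ (f k)) (≃-trans (substP-cong _ e) (horner-rename θ θ′ θv≡w θ∘punchIn f m))

  -- Division with remainder by a monic polynomial

  infix 8 _at_
  _at_ : ∀ {n} → Monic → Fin n → Poly n
  g at v = substP (λ _ → var v) (toPoly g)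

  weakenAt-zero : ∀ {n} (x : Poly n) → weakenAt zero x ≃ lift x
  weakenAt-zero x = ≃-trans (substP-lift var x) (lift-cong (substP-var-id x))

  horner-zero : ∀ {n} f m → horner {n} zero f m ≃ pol (applyUpTo f m)
  horner-zero f zero    = ≃-refl
  horner-zero f (suc m) =
    ≃-trans (+-cong (weakenAt-zero (f 0)) (*-congˡ X₀ (horner-zero (λ k → f (suc k)) m))) (≃-sym (pol-∷ _ _))

  at-zero : ∀ {n} (g : Monic) → g at zero ≃ pol {n} (L.monic (map constP g))
  at-zero {n} []  = ≃-trans (+-congˡ (constP R.1#) (zeroʳ (X₀ {n}))) (≃-trans (+-identityʳ (constP R.1#)) (lift-cong constP-1))
  at-zero (b ∷ g) = ≃-trans (+-congˡ _ (*-congˡ X₀ (at-zero g))) (≃-sym (pol-∷ (constP b) _))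

  reduced-multiple-at-zero : ∀ {n} (g : Monic) {P q : Poly (suc n)} →
                             Reduced zero (deg g) P → P ≃ g at zero *P q → P ≃ 0P
  reduced-multiple-at-zero {n} g {P} {pol Q} (reduced f P≃) P≃gq = begin
    P                   ≈⟨ P≃gq ⟩
    g at zero *P pol Q  ≈⟨ *-congˡ _ (pol-cong (L.degreeBelow-0 (L.degreeBelow-*-monic G 0 Q QG-degree))) ⟩
    g at zero *P 0P     ≈⟨ zeroʳ _ ⟩
    0P                  ∎
    where
    open ≃-Reasoning
    G = map (constP {n}) g
    Ps = applyUpTo f (deg g)
    Ps≈QG : L._≈ᶜ_ Ps (Q L.*L L.monic G)
    Ps≈QG = pol-injective (begin
      pol Ps                 ≈⟨ ≃-trans P≃ (horner-zero f (deg g)) ⟨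
      P                      ≈⟨ P≃gq ⟩
      g at zero *P pol Q     ≈⟨ *-congʳ (at-zero g) (pol Q) ⟩
      pol (L.monic G) *P pol Q ≈⟨ *-comm (pol (L.monic G)) (pol Q) ⟩
      pol (Q L.*L L.monic G) ∎)
    length-Ps : length G ℕ.+ 0 ≡ length Ps
    length-Ps = ≡.trans (ℕ.+-identityʳ _) (≡.trans (length-map constP g) (≡.sym (length-applyUpTo f (deg g))))
    QG-degree : L.DegreeBelow (Q L.*L L.monic G) (length G ℕ.+ 0)
    QG-degree i le = ≃-trans (≃-sym (L.at Ps≈QG i)) (L.degreeBelow-length Ps i (≡.subst (_≤ i) length-Ps le))

  toFront : ∀ {n} → Fin (suc n) → Fin (suc n) → Fin (suc n)
  toFront v i with v Fin.≟ i
  ... | yes _   = zero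
  ... | no v≢i = suc (Fin.punchOut v≢i)

  fromFront : ∀ {n} → Fin (suc n) → Fin (suc n) → Fin (suc n)
  fromFront v zero    = v
  fromFront v (suc j) = punchIn v j

  toFront-self : ∀ {n} (v : Fin (suc n)) → toFront v v ≡ zero
  toFront-self v with v Fin.≟ v
  ... | yes _   = ≡.refl
  ... | no v≢v = ⊥-elim (v≢v ≡.refl)

  toFront-punchIn : ∀ {n} (v : Fin (suc n)) j → toFront v (punchIn v j) ≡ suc j
  toFront-punchIn v j with v Fin.≟ punchIn v j
  ... | yes v≡ = ⊥-elim (Fin.punchInᵢ≢i v j (≡.sym v≡))
  ... | no v≢  = ≡.cong suc (≡.trans (Fin.punchOut-cong v ≡.refl) (Fin.punchOut-punchIn v))

  fromFront-toFront : ∀ {n} (v : Fin (suc n)) i → fromFront v (toFront v i) ≡ i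
  fromFront-toFront v i with v Fin.≟ i
  ... | yes v≡i = v≡i
  ... | no v≢i = Fin.punchIn-punchOut v≢i

  rename-at : ∀ {a b} (θ : Fin a → Fin b) v g → rename θ (g at v) ≃ g at θ v
  rename-at θ v g = ≃-trans (substP-∘ (λ i → var (θ i)) (λ _ → var v) (toPoly g))
                            (substP-ext (λ _ → substP-var (λ i → var (θ i)) v) (toPoly g))

  rename-at-at : ∀ {a b} (θ : Fin a → Fin b) x y g → rename θ (g at x -P g at y) ≃ g at θ x -P g at θ y
  rename-at-at θ x y g = ≃-trans (substP-- (λ i → var (θ i)) (g at x) (g at y)) (+-cong (rename-at θ x g) (-‿cong (rename-at θ y g)))

  substP-at : ∀ {a b} (σ : Fin a → Poly b) v g → substP σ (g at v) ≃ substP (λ _ → σ v) (toPoly g)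
  substP-at σ v g = ≃-trans (substP-∘ σ (λ _ → var v) (toPoly g)) (substP-ext (λ _ → substP-var σ v) (toPoly g))

  rename-fromFront-toFront : ∀ {n} (v : Fin (suc n)) p → rename (fromFront v) (rename (toFront v) p) ≃ p
  rename-fromFront-toFront v p = ≃-trans (rename-∘ (fromFront v) (toFront v) p) (rename-id (fromFront-toFront v) p)

  reduced-multiple : ∀ {n} (v : Fin (suc n)) (g : Monic) {P q : Poly (suc n)} →
                     Reduced v (deg g) P → P ≃ g at v *P q → P ≃ 0P
  reduced-multiple v g {P} {q} rP P≃gq = begin
    P                                           ≈⟨ rename-fromFront-toFront v P ⟨
    rename (fromFront v) (rename (toFront v) P) ≈⟨ substP-cong _ atFront≃0 ⟩
    rename (fromFront v) 0P                     ≈⟨ substP-0 (λ i → var (fromFront v i)) ⟩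
    0P                                          ∎
    where
    open ≃-Reasoning
    atFront≃0 : rename (toFront v) P ≃ 0P
    atFront≃0 = reduced-multiple-at-zero g
      (reduced-rename (toFront v) (λ j → j) (toFront-self v) (toFront-punchIn v) rP)
      (≃-trans (substP-cong _ P≃gq) (≃-trans (substP-* _ (g at v) q)
        (*-congʳ (≃-trans (rename-at (toFront v) v g) (≃-reflexive (≡.cong (g at_) (toFront-self v)))) _)))

  reduced-unique : ∀ {n} (v : Fin (suc n)) g {P Q : Poly (suc n)} →
                   Reduced v (deg g) P → Reduced v (deg g) Q → P ≃ Q mod g at v → P ≃ Q
  reduced-unique v g {P} {Q} rP rQ P≡Q = RP.x∙y⁻¹≈ε⇒x≈y P Q (reduced-multiple v g (reduced-− rP rQ) (mod-difference P≡Q))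

  reduced-pol : ∀ {n} (xs : List (Poly n)) → Reduced zero (length xs) (pol xs)
  reduced-pol xs = reduced (L.coefficient xs)
    (≃-sym (≃-trans (horner-zero (L.coefficient xs) (length xs)) (≃-reflexive (≡.cong pol (applyUpTo-coefficient xs)))))
    where
    applyUpTo-coefficient : ∀ xs → applyUpTo (L.coefficient xs) (length xs) ≡ xs
    applyUpTo-coefficient []       = ≡.refl
    applyUpTo-coefficient (x ∷ xs) = ≡.cong (x ∷_) (applyUpTo-coefficient xs)

  pol-replicate-0P : ∀ {n} m → pol (toList (Vec.replicate m (0P {n}))) ≃ 0P
  pol-replicate-0P m = pol-cong (L.coefficientwise (coefficient-0 m))
    where
    coefficient-0 : ∀ m i → L.coefficient (toList (Vec.replicate m 0P)) i ≃ 0P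
    coefficient-0 zero    i       = ≃-refl
    coefficient-0 (suc m) zero    = ≃-refl
    coefficient-0 (suc m) (suc i) = coefficient-0 m i

  pol-monic : ∀ {n} (xs : List (Poly n)) → pol (L.monic xs) ≃ pol xs +P powP X₀ (length xs)
  pol-monic []       = ≃-sym (+-identityˡ _)
  pol-monic (x ∷ xs) = begin
    pol (x ∷ L.monic xs)                               ≈⟨ pol-∷ x (L.monic xs) ⟩
    lift x +P X₀ *P pol (L.monic xs)                   ≈⟨ +-congˡ (lift x) (*-congˡ X₀ (pol-monic xs)) ⟩
    lift x +P X₀ *P (pol xs +P powP X₀ (length xs))    ≈⟨ Solver.solve 4 (λ a X p e → a :+ X :* (p :+ e) := (a :+ X :* p) :+ X :* e)
                                                           ≃-refl (lift x) X₀ (pol xs) (powP X₀ (length xs)) ⟩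
    (lift x +P X₀ *P pol xs) +P X₀ *P powP X₀ (length xs) ≈⟨ +-congʳ (pol-∷ x xs) _ ⟨
    pol (x ∷ xs) +P powP X₀ (suc (length xs))          ∎
    where open ≃-Reasoning

  pol-init-last : ∀ {n} m (r : Vec (Poly n) (suc m)) →
                  pol (toList r) ≃ pol (toList (Vec.init r)) +P powP X₀ m *P lift (Vec.last r)
  pol-init-last zero    (x ∷ []) = ≃-sym (≃-trans (+-identityˡ _) (*-identityˡ _))
  pol-init-last (suc m) (x ∷ xs) = begin
    pol (x ∷ toList xs)                                     ≈⟨ pol-∷ x (toList xs) ⟩
    lift x +P X₀ *P pol (toList xs)                         ≈⟨ +-congˡ (lift x) (*-congˡ X₀ (pol-init-last m xs)) ⟩
    lift x +P X₀ *P (pol (toList (Vec.init xs)) +P E)       ≈⟨ Solver.solve 4 (λ a X p e → a :+ X :* (p :+ e) := (a :+ X :* p) :+ X :* e)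
                                                                ≃-refl (lift x) X₀ (pol (toList (Vec.init xs))) E ⟩
    (lift x +P X₀ *P pol (toList (Vec.init xs))) +P X₀ *P E ≈⟨ +-cong (≃-sym (pol-∷ x _)) (≃-sym (*-assoc X₀ (powP X₀ m) _)) ⟩
    pol (x ∷ toList (Vec.init xs)) +P powP X₀ (suc m) *P lift (Vec.last xs) ∎
    where
    open ≃-Reasoning
    E = powP X₀ m *P lift (Vec.last xs)

  pol-zipWith : ∀ {n k} (u : Vec (Poly n) k) (bs : Vec R.Carrier k) (a : Poly n) →
                pol (toList (Vec.zipWith (λ s b → s -P a *P constP b) u bs))
                  ≃ pol (toList u) -P lift a *P pol (toList (Vec.map constP bs))
  pol-zipWith [] [] a = ≃-sym (≃-trans (+-congˡ 0P (≃-trans (-‿cong (zeroʳ (lift a))) RP.-0#≈0#)) (+-identityʳ 0P))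
  pol-zipWith (s ∷ u) (b ∷ bs) a = begin
    pol ((s -P a *P constP b) ∷ toList (Vec.zipWith _ u bs))
      ≈⟨ pol-∷ _ _ ⟩
    lift (s -P a *P constP b) +P X₀ *P pol (toList (Vec.zipWith _ u bs))
      ≈⟨ +-cong (+-congˡ (lift s) (-‿cong (lift-* a (constP b)))) (*-congˡ X₀ (pol-zipWith u bs a)) ⟩
    (lift s -P lift a *P lift (constP b)) +P X₀ *P (pol (toList u) -P lift a *P pol (toList (Vec.map constP bs)))
      ≈⟨ Solver.solve 6 (λ S A B X U V → (S :- A :* B) :+ X :* (U :- A :* V) := (S :+ X :* U) :- A :* (B :+ X :* V))
           ≃-refl (lift s) (lift a) (lift (constP b)) X₀ (pol (toList u)) (pol (toList (Vec.map constP bs))) ⟩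
    (lift s +P X₀ *P pol (toList u)) -P lift a *P (lift (constP b) +P X₀ *P pol (toList (Vec.map constP bs)))
      ≈⟨ +-cong (pol-∷ s (toList u)) (-‿cong (*-congˡ (lift a) (pol-∷ (constP b) _))) ⟨
    pol (s ∷ toList u) -P lift a *P pol (constP b ∷ toList (Vec.map constP bs)) ∎
    where open ≃-Reasoning

  -- One step of remTop: it computes (a + X₀ r) mod g by subtracting (last r) · g(X₀).
  step-≃ : ∀ {n} (b : R.Carrier) (g : Monic) (a : Poly n) (r : Vec (Poly n) (suc (length g))) →
           pol (toList (step (Vec.fromList (b ∷ g)) a r))
             ≃ (lift a +P X₀ *P pol (toList r)) +P (b ∷ g) at zero *P (-P lift (Vec.last r))
  step-≃ {n} b g a r = begin
    pol (toList (step (Vec.fromList (b ∷ g)) a r))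
      ≈⟨ pol-zipWith (a ∷ Vec.init r) (Vec.fromList (b ∷ g)) (Vec.last r) ⟩
    pol (a ∷ toList (Vec.init r)) -P top *P pol (toList (Vec.map constP (Vec.fromList (b ∷ g))))
      ≈⟨ +-cong (pol-∷ a (toList (Vec.init r))) (-‿cong (*-congˡ top (≃-reflexive (≡.cong pol coefficients)))) ⟩
    (lift a +P X₀ *P I) -P top *P G
      ≈⟨ Solver.solve 6 (λ A X I T G E → (A :+ X :* I) :- T :* G := (A :+ X :* (I :+ E :* T)) :+ (G :+ X :* E) :* (:- T))
           ≃-refl (lift a) X₀ I top G (powP X₀ (length g)) ⟩
    (lift a +P X₀ *P (I +P powP X₀ (length g) *P top)) +P (G +P X₀ *P powP X₀ (length g)) *P (-P top)
      ≈⟨ +-cong (+-congˡ (lift a) (*-congˡ X₀ (pol-init-last (length g) r)))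
                (*-congʳ (≃-trans (pol-monic (map constP (b ∷ g))) (+-congˡ G (≃-reflexive (≡.cong (powP X₀) (length-map constP (b ∷ g))))))
                         (-P top)) ⟨
    (lift a +P X₀ *P pol (toList r)) +P pol (L.monic (map constP (b ∷ g))) *P (-P top)
      ≈⟨ +-congˡ _ (*-congʳ (at-zero (b ∷ g)) (-P top)) ⟨
    (lift a +P X₀ *P pol (toList r)) +P (b ∷ g) at zero *P (-P top) ∎
    where
    open ≃-Reasoning
    top = lift (Vec.last r)
    I = pol (toList (Vec.init r))
    G = pol (map (constP {n}) (b ∷ g))
    coefficients : toList (Vec.map constP (Vec.fromList (b ∷ g))) ≡ map constP (b ∷ g)
    coefficients = ≡.trans (toList-map constP (Vec.fromList (b ∷ g))) (≡.cong (map constP) (toList∘fromList (b ∷ g)))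

  remTop-≃ : ∀ {n} (g : Monic) (p : Poly (suc n)) → remTop g p ≃ p mod g at zero
  remTop-≃ g (pol ps) = go g ps
    where
    go : ∀ {n} g (ps : List (Poly n)) →
         pol (toList (foldr (step (Vec.fromList g)) (Vec.replicate (length g) 0P) ps)) ≃ pol ps mod g at zero
    go []      ps       = mod-cong ≃-refl ≃-refl (≃-sym (at-zero [])) (mod-1 _ (pol ps))
    go (b ∷ g) []       = ≃⇒≃mod (pol-replicate-0P (suc (length g)))
    go (b ∷ g) (a ∷ ps) = mod-cong ≃-refl (≃-sym (pol-∷ a ps)) ≃-refl
      (mod-trans (via (-P lift (Vec.last r)) (step-≃ b g a r)) (mod-+ (mod-refl {a = lift a}) (mod-*ˡ X₀ (go (b ∷ g) ps))))
      where r = foldr (step (Vec.fromList (b ∷ g))) (Vec.replicate (length (b ∷ g)) 0P) ps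

  remTop-reduced : ∀ {n} (g : Monic) (p : Poly (suc n)) → Reduced zero (deg g) (remTop g p)
  remTop-reduced g (pol ps) = reduced-mono (ℕ.≤-reflexive (length-toList r)) (reduced-pol (toList r))
    where r = foldr (step (Vec.fromList g)) (Vec.replicate (length g) 0P) ps

  record Remainder {n} (v : Fin (suc n)) (g : Monic) (P : Poly (suc n)) : Set (c ⊔ ℓ) where
    field
      remainder         : Poly (suc n)
      remainder-reduced : Reduced v (deg g) remainder
      remainder-≃       : remainder ≃ P mod g at v
  open Remainder public

  divide : ∀ {n} (v : Fin (suc n)) (g : Monic) (P : Poly (suc n)) → Remainder v g P
  divide v g P = record
    { remainder         = rename (fromFront v) (remTop g (rename (toFront v) P))
    ; remainder-reduced = reduced-rename (fromFront v) (λ j → j) ≡.refl (λ _ → ≡.refl) (remTop-reduced g (rename (toFront v) P))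
    ; remainder-≃       = mod-cong ≃-refl (rename-fromFront-toFront v P) (rename-at (fromFront v) zero g)
                                   (mod-substP (λ i → var (fromFront v i)) (remTop-≃ g (rename (toFront v) P)))
    }

  -- The operator O⁽²⁾

  Y₁ : Poly 2
  Y₁ = var (suc zero)

  map-applyUpTo : ∀ {b} {B : Set b} (F : ℕ → B) (f : ℕ → ℕ) m → map F (applyUpTo f m) ≡ applyUpTo (λ k → F (f k)) m
  map-applyUpTo F f zero    = ≡.refl
  map-applyUpTo F f (suc m) = ≡.cong (F (f 0) ∷_) (map-applyUpTo F (λ k → f (suc k)) m)

  sumP-applyUpTo-cong : ∀ {n} {F G : ℕ → Poly n} → (∀ k → F k ≃ G k) → ∀ m → sumP (applyUpTo F m) ≃ sumP (applyUpTo G m)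
  sumP-applyUpTo-cong e zero    = ≃-refl
  sumP-applyUpTo-cong e (suc m) = +-cong (e 0) (sumP-applyUpTo-cong (λ k → e (suc k)) m)

  sumP-applyUpTo-factor : ∀ {n} (A B : ℕ → Poly n) (Y : Poly n) m →
    sumP (applyUpTo (λ k → A k *P (Y *P B k)) m) ≃ Y *P sumP (applyUpTo (λ k → A k *P B k) m)
  sumP-applyUpTo-factor A B Y zero    = ≃-sym (zeroʳ Y)
  sumP-applyUpTo-factor A B Y (suc m) =
    ≃-trans (+-congˡ _ (sumP-applyUpTo-factor (λ k → A (suc k)) (λ k → B (suc k)) Y m))
            (Solver.solve 4 (λ a y b s → a :* (y :* b) :+ y :* s := y :* (a :* b :+ s)) ≃-refl (A 0) Y (B 0) _)

  sumP-applyUpTo-horner : ∀ {n} (v : Fin (suc n)) (f : ℕ → Poly n) (A : ℕ → Poly (suc n)) →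
    (∀ k → A k ≃ weakenAt v (f k)) → ∀ m → sumP (applyUpTo (λ k → A k *P powP (var v) k) m) ≃ horner v f m
  sumP-applyUpTo-horner v f A e zero    = ≃-refl
  sumP-applyUpTo-horner v f A e (suc m) = +-cong (≃-trans (*-identityʳ (A 0)) (e 0))
    (≃-trans (sumP-applyUpTo-factor (λ k → A (suc k)) (powP (var v)) (var v) m)
             (*-congˡ (var v) (sumP-applyUpTo-horner v (λ k → f (suc k)) (λ k → A (suc k)) (λ k → e (suc k)) m)))

  sumP-coeff : ∀ (g : Monic) → sumP (applyUpTo (λ j → constP (coeff g j) *P powP X₀ j) (suc (deg g))) ≃ toPoly g
  sumP-coeff []      = ≃-trans (+-identityʳ _) (*-identityʳ _)
  sumP-coeff (b ∷ g) = begin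
    constP b *P 1P +P sumP (applyUpTo (λ j → constP (coeff g j) *P (X₀ *P powP X₀ j)) (suc (deg g)))
      ≈⟨ +-cong (*-identityʳ (constP b)) (sumP-applyUpTo-factor (λ j → constP (coeff g j)) (powP X₀) X₀ (suc (deg g))) ⟩
    constP b +P X₀ *P sumP (applyUpTo (λ j → constP (coeff g j) *P powP X₀ j) (suc (deg g)))
      ≈⟨ +-congˡ (constP b) (*-congˡ X₀ (sumP-coeff g)) ⟩
    lift (cst b) +P X₀ *P toPoly g
      ≈⟨ pol-∷ (cst b) (map cst g ++ cst R.1# ∷ []) ⟨
    toPoly (b ∷ g) ∎
    where open ≃-Reasoning

  Dmono-0 : ∀ (b : R.Carrier) (g : Monic) → Dmono (b ∷ g) 0 ≃ toPoly g
  Dmono-0 b g = ≃-trans (≃-reflexive (≡.cong sumP (map-applyUpTo _ (λ j → j) (suc (deg g)))))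
    (≃-trans (sumP-applyUpTo-cong (λ j → ≃-reflexive (≡.cong (λ i → constP (coeff (b ∷ g) i) *P powP X₀ j) (ℕ.+-comm j 1)))
                                  (suc (deg g)))
             (sumP-coeff g))

  O2-unfold : ∀ g → O2 g ≡ sumP (applyUpTo (λ k → substP (λ _ → X₀) (Dmono g k) *P powP Y₁ k) (deg g))
  O2-unfold g = ≡.cong sumP (map-applyUpTo _ (λ k → k) (deg g))

  -- Dmono (b ∷ g) (suc k) is Dmono g k by definition, so only the constant term needs Dmono-0.
  O2-∷ : ∀ b g → O2 (b ∷ g) ≃ g at zero +P Y₁ *P O2 g
  O2-∷ b g = begin
    O2 (b ∷ g)
      ≡⟨ O2-unfold (b ∷ g) ⟩
    substP (λ _ → X₀) (Dmono (b ∷ g) 0) *P 1P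
      +P sumP (applyUpTo (λ k → substP (λ _ → X₀) (Dmono g k) *P (Y₁ *P powP Y₁ k)) (deg g))
      ≈⟨ +-cong (≃-trans (*-identityʳ _) (substP-cong (λ _ → X₀) (Dmono-0 b g)))
                (sumP-applyUpTo-factor (λ k → substP (λ _ → X₀) (Dmono g k)) (powP Y₁) Y₁ (deg g)) ⟩
    g at zero +P Y₁ *P sumP (applyUpTo (λ k → substP (λ _ → X₀) (Dmono g k) *P powP Y₁ k) (deg g))
      ≡⟨ ≡.cong (λ s → g at zero +P Y₁ *P s) (≡.sym (O2-unfold g)) ⟩
    g at zero +P Y₁ *P O2 g ∎
    where open ≃-Reasoning

  O2-divided-difference : ∀ g → (X₀ -P Y₁) *P O2 g ≃ g at zero -P g at suc zero
  O2-divided-difference [] =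
    Solver.solve 3 (λ x y a → (x :- y) :* con (0 , 0) := (a :+ x :* con (0 , 0)) :- (a :+ y :* con (0 , 0)))
      ≃-refl X₀ Y₁ (constP R.1#)
  O2-divided-difference (b ∷ g) = begin
    (X₀ -P Y₁) *P O2 (b ∷ g)
      ≈⟨ *-congˡ (X₀ -P Y₁) (O2-∷ b g) ⟩
    (X₀ -P Y₁) *P (g at zero +P Y₁ *P O2 g)
      ≈⟨ Solver.solve 4 (λ x y a o → (x :- y) :* (a :+ y :* o) := (x :- y) :* a :+ y :* ((x :- y) :* o))
           ≃-refl X₀ Y₁ (g at zero) (O2 g) ⟩
    (X₀ -P Y₁) *P g at zero +P Y₁ *P ((X₀ -P Y₁) *P O2 g)
      ≈⟨ +-congˡ _ (*-congˡ Y₁ (O2-divided-difference g)) ⟩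
    (X₀ -P Y₁) *P g at zero +P Y₁ *P (g at zero -P g at suc zero)
      ≈⟨ Solver.solve 5 (λ x y a a′ β → (x :- y) :* a :+ y :* (a :- a′) := (β :+ x :* a) :- (β :+ y :* a′))
           ≃-refl X₀ Y₁ (g at zero) (g at suc zero) (constP b) ⟩
    (b ∷ g) at zero -P (b ∷ g) at suc zero ∎
    where open ≃-Reasoning

  *-monic-cancel : ∀ {n} (hs : List (Poly n)) (Q : Poly (suc n)) → pol (L.monic hs) *P Q ≃ 0P → Q ≃ 0P
  *-monic-cancel hs (pol Q) hQ≃0 = pol-cong (L.degreeBelow-0 (L.degreeBelow-*-monic hs 0 Q degree))
    where
    degree : L.DegreeBelow (Q L.*L L.monic hs) (length hs ℕ.+ 0)
    degree i _ = L.at (pol-injective (≃-trans (*-comm (pol Q) (pol (L.monic hs))) hQ≃0)) i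

  X₀-lift-cancel : ∀ {n} (a : Poly n) (Q : Poly (suc n)) → (X₀ -P lift a) *P Q ≃ 0P → Q ≃ 0P
  X₀-lift-cancel a Q e = *-monic-cancel (-P a ∷ []) Q (≃-trans (*-congʳ (≃-sym X₀-lift≃) Q) e)
    where
    X₀-lift≃ : X₀ -P lift a ≃ pol (L.monic (-P a ∷ []))
    X₀-lift≃ = pol-cong (L.coefficientwise λ { zero → +-identityˡ (-P a) ; (suc zero) → ≃-refl ; (suc (suc i)) → ≃-refl })

  swap₂ : Fin 2 → Fin 2
  swap₂ zero    = suc zero
  swap₂ (suc _) = zero

  O2-swap : ∀ g → rename swap₂ (O2 g) ≃ O2 g
  O2-swap g = RP.x∙y⁻¹≈ε⇒x≈y _ _ (X₀-lift-cancel (var zero) (rename swap₂ (O2 g) -P O2 g) (begin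
    (X₀ -P Y₁) *P (swapped -P O2 g)
      ≈⟨ Solver.solve 4 (λ x y s o → (x :- y) :* (s :- o) := (:- ((y :- x) :* s)) :- (x :- y) :* o) ≃-refl X₀ Y₁ swapped (O2 g) ⟩
    (-P ((Y₁ -P X₀) *P swapped)) -P (X₀ -P Y₁) *P O2 g
      ≈⟨ +-cong (-‿cong swapped-dd) (-‿cong (O2-divided-difference g)) ⟩
    (-P (g at suc zero -P g at zero)) -P (g at zero -P g at suc zero)
      ≈⟨ Solver.solve 2 (λ a b → (:- (b :- a)) :- (a :- b) := con (0 , 0)) ≃-refl (g at zero) (g at suc zero) ⟩
    0P ∎))
    where
    open ≃-Reasoning
    swapped = rename swap₂ (O2 g)
    swapped-dd : (Y₁ -P X₀) *P swapped ≃ g at suc zero -P g at zero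
    swapped-dd = begin
      (Y₁ -P X₀) *P swapped                             ≈⟨ *-congʳ (rename-var-var swap₂ zero (suc zero)) swapped ⟨
      rename swap₂ (X₀ -P Y₁) *P swapped                ≈⟨ substP-* _ (X₀ -P Y₁) (O2 g) ⟨
      rename swap₂ ((X₀ -P Y₁) *P O2 g)                 ≈⟨ substP-cong _ (O2-divided-difference g) ⟩
      rename swap₂ (g at zero -P g at suc zero)         ≈⟨ rename-at-at swap₂ zero (suc zero) g ⟩
      g at suc zero -P g at zero                        ∎

  O2-reduced : ∀ g → Reduced (suc zero) (deg g) (O2 g)
  O2-reduced g = reduced (Dmono g) (≃-trans (≃-reflexive (O2-unfold g))
    (sumP-applyUpTo-horner (suc zero) (Dmono g) (λ k → substP (λ _ → X₀) (Dmono g k))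
                           (λ k → substP-ext (λ { zero → ≃-refl }) (Dmono g k)) (deg g)))

  Π : ∀ {n} K → (Fin K → Poly n) → Poly n
  Π K h = prodP (List.tabulate h)

  prodP-allFin : ∀ {n} K (h : Fin K → Poly n) → prodP (map h (allFin K)) ≡ Π K h
  prodP-allFin K h = ≡.cong prodP (map-tabulate (λ i → i) h)

  Π-cong : ∀ {n} K {h h′ : Fin K → Poly n} → (∀ j → h j ≃ h′ j) → Π K h ≃ Π K h′
  Π-cong zero    e = ≃-refl
  Π-cong (suc K) e = *-cong (e zero) (Π-cong K (λ j → e (suc j)))

  Π-* : ∀ {n} K (a b : Fin K → Poly n) → Π K (λ j → a j *P b j) ≃ Π K a *P Π K b
  Π-* zero    a b = ≃-sym (*-identityˡ 1P)
  Π-* (suc K) a b = ≃-trans (*-congˡ (a zero *P b zero) (Π-* K (λ j → a (suc j)) (λ j → b (suc j))))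
    (Solver.solve 4 (λ x y u v → (x :* y) :* (u :* v) := (x :* u) :* (y :* v)) ≃-refl (a zero) (b zero) _ _)

  Π-punchIn : ∀ {n} K (h : Fin (suc K) → Poly n) i → Π (suc K) h ≃ h i *P Π K (λ j → h (punchIn i j))
  Π-punchIn K       h zero    = ≃-refl
  Π-punchIn (suc K) h (suc i) = ≃-trans (*-congˡ (h zero) (Π-punchIn K (λ j → h (suc j)) i))
    (Solver.solve 3 (λ x y z → x :* (y :* z) := y :* (x :* z)) ≃-refl (h zero) (h (suc i)) _)

  substP-Π : ∀ {n k} (ρ : Fin n → Poly k) K (h : Fin K → Poly n) → substP ρ (Π K h) ≃ Π K (λ j → substP ρ (h j))
  substP-Π ρ zero    h = substP-1 ρ
  substP-Π ρ (suc K) h = ≃-trans (substP-* ρ (h zero) (Π K (λ j → h (suc j))))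
                                 (*-congˡ (substP ρ (h zero)) (substP-Π ρ K (λ j → h (suc j))))

  mod-Π : ∀ {n} {d : Poly n} K (f g : Fin K → Poly n) → (∀ j → f j ≃ g j mod d) → Π K f ≃ Π K g mod d
  mod-Π zero    f g e = mod-refl
  mod-Π (suc K) f g e = mod-* (e zero) (mod-Π K (λ j → f (suc j)) (λ j → g (suc j)) (λ j → e (suc j)))

  -- The Weil operators as reduced remainders

  pair : ∀ {k} → Fin k → Fin k → Fin 2 → Fin k
  pair a b zero    = a
  pair a b (suc _) = b

  O2At : ∀ {k} → Monic → Fin k → Fin k → Poly k
  O2At g a b = rename (pair a b) (O2 g)

  -- Π_{j<n} O⁽²⁾(X_j, X_n), to which O⁽ⁿ⁺¹⁾ is congruent modulo g(X_n)
  O2Product : Monic → ∀ n → Poly (suc n)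
  O2Product g n = Π n (λ j → O2At g (inject₁ j) (fromℕ n))

  punchIn-fromℕ : ∀ {n} (j : Fin n) → punchIn (fromℕ n) j ≡ inject₁ j
  punchIn-fromℕ zero    = ≡.refl
  punchIn-fromℕ (suc j) = ≡.cong suc (punchIn-fromℕ j)

  toLast : ∀ {n} → Fin (suc n) → Fin (suc n)
  toLast zero    = fromℕ _
  toLast (suc j) = inject₁ j

  at-[] : ∀ {n} (v : Fin n) → [] at v ≃ 1P
  at-[] v = ≃-trans (+-congˡ (constP R.1#) (zeroʳ (var v))) (≃-trans (+-identityʳ _) constP-1)

  -- Ohigh g k is  substP ρ (remTop g (prodP (map (λ j → substP (τ j) (O2 g)) (allFin (2 + k)))))
  -- for a local renaming ρ and local substitutions τ, which are accessible only through their
  -- defining equations; the next two lemmas are stated for any such ρ and τ.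
  module _ (g : Monic) (k : ℕ) (ρ : Fin (3 ℕ.+ k) → Poly (3 ℕ.+ k)) (τ : Fin (2 ℕ.+ k) → Fin 2 → Poly (3 ℕ.+ k))
           (ρ≃ : ∀ i → ρ i ≃ var (toLast i)) where

    private
      factors : Fin (2 ℕ.+ k) → Poly (3 ℕ.+ k)
      factors j = substP (τ j) (O2 g)
      product : Poly (3 ℕ.+ k)
      product = prodP (map factors (allFin (2 ℕ.+ k)))

    Ohigh-reduced : Reduced (fromℕ (2 ℕ.+ k)) (deg g) (substP ρ (remTop g product))
    Ohigh-reduced = reduced-cong (≃-sym (substP-ext ρ≃ (remTop g product)))
      (reduced-rename toLast (λ j → j) ≡.refl (λ j → ≡.sym (punchIn-fromℕ j)) (remTop-reduced g product))

    Ohigh-≃ : (∀ j → τ j zero ≃ var (suc j)) → (∀ j x → τ j (suc x) ≃ var zero) →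
              substP ρ (remTop g product) ≃ O2Product g (2 ℕ.+ k) mod g at fromℕ (2 ℕ.+ k)
    Ohigh-≃ τ₀ τ₁ = mod-cong ≃-refl product≃ modulus≃ (mod-substP ρ (remTop-≃ g product))
      where
      modulus≃ : substP ρ (g at zero) ≃ g at fromℕ (2 ℕ.+ k)
      modulus≃ = ≃-trans (substP-at ρ zero g) (substP-ext (λ _ → ρ≃ zero) (toPoly g))
      factor≃ : ∀ j → substP ρ (factors j) ≃ O2At g (inject₁ j) (fromℕ (2 ℕ.+ k))
      factor≃ j = ≃-trans (substP-∘ ρ (τ j) (O2 g)) (substP-ext
        (λ { zero    → ≃-trans (substP-cong ρ (τ₀ j)) (≃-trans (substP-var ρ (suc j)) (ρ≃ (suc j)))
           ; (suc x) → ≃-trans (substP-cong ρ (τ₁ j x)) (≃-trans (substP-var ρ zero) (ρ≃ zero)) }) (O2 g))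
      product≃ : substP ρ product ≃ O2Product g (2 ℕ.+ k)
      product≃ = ≃-trans (substP-cong ρ (≃-reflexive (prodP-allFin (2 ℕ.+ k) factors)))
                         (≃-trans (substP-Π ρ (2 ℕ.+ k) factors) (Π-cong (2 ℕ.+ k) factor≃))

  Weil-reduced : ∀ g n → Reduced (fromℕ n) (deg g) (Weil g (suc n))
  Weil-reduced []      n             = reduced-0
  Weil-reduced (b ∷ g) zero          = reduced-mono (s≤s z≤n) (reduced-weakenAt 1P)
  Weil-reduced (b ∷ g) (suc zero)    = O2-reduced (b ∷ g)
  Weil-reduced (b ∷ g) (suc (suc k)) = Ohigh-reduced (b ∷ g) k _ _ (λ { zero → ≃-refl ; (suc j) → ≃-refl })

  Weil-≃-O2Product : ∀ g n → Weil g (suc n) ≃ O2Product g n mod g at fromℕ n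
  Weil-≃-O2Product []      n             = mod-cong ≃-refl ≃-refl (≃-sym (at-[] (fromℕ n))) (mod-1 _ _)
  Weil-≃-O2Product (b ∷ g) zero          = mod-refl
  Weil-≃-O2Product (b ∷ g) (suc zero)    =
    ≃⇒≃mod (≃-sym (≃-trans (*-identityʳ _) (rename-id (λ { zero → ≡.refl ; (suc zero) → ≡.refl }) (O2 (b ∷ g)))))
  Weil-≃-O2Product (b ∷ g) (suc (suc k)) =
    Ohigh-≃ (b ∷ g) k _ _ (λ { zero → ≃-refl ; (suc j) → ≃-refl }) (λ j → ≃-refl) (λ j x → ≃-refl)

  -- Symmetry of the Weil operators in their last two variables Xₚ and Xᵤ

  punchIn-inject₁ : ∀ {n} (i : Fin (suc n)) (j : Fin n) → punchIn (inject₁ i) (inject₁ j) ≡ inject₁ (punchIn i j)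
  punchIn-inject₁ zero    j       = ≡.refl
  punchIn-inject₁ (suc i) zero    = ≡.refl
  punchIn-inject₁ (suc i) (suc j) = ≡.cong suc (punchIn-inject₁ i j)

  punchIn-inject₁-fromℕ : ∀ {n} (i : Fin (suc n)) → punchIn (inject₁ i) (fromℕ n) ≡ fromℕ (suc n)
  punchIn-inject₁-fromℕ zero            = ≡.refl
  punchIn-inject₁-fromℕ {suc n} (suc i) = ≡.cong suc (punchIn-inject₁-fromℕ i)

  ultimate penultimate : ∀ {k} → Fin (2 ℕ.+ k)
  ultimate    {k} = fromℕ (suc k)
  penultimate {k} = inject₁ (fromℕ k)

  swapLast : ∀ {k} → Fin (2 ℕ.+ k) → Fin (2 ℕ.+ k)
  swapLast {zero}  zero    = suc zero
  swapLast {zero}  (suc _) = zero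
  swapLast {suc k} zero    = zero
  swapLast {suc k} (suc i) = suc (swapLast i)

  swapLast-ultimate : ∀ k → swapLast (ultimate {k}) ≡ penultimate
  swapLast-ultimate zero    = ≡.refl
  swapLast-ultimate (suc k) = ≡.cong suc (swapLast-ultimate k)

  swapLast-penultimate : ∀ k → swapLast (penultimate {k}) ≡ ultimate
  swapLast-penultimate zero    = ≡.refl
  swapLast-penultimate (suc k) = ≡.cong suc (swapLast-penultimate k)

  swapLast-punchIn-penultimate : ∀ {k} (j : Fin (suc k)) → swapLast (punchIn (penultimate {k}) j) ≡ punchIn ultimate j
  swapLast-punchIn-penultimate {zero}  zero    = ≡.refl
  swapLast-punchIn-penultimate {suc k} zero    = ≡.refl
  swapLast-punchIn-penultimate {suc k} (suc j) = ≡.cong suc (swapLast-punchIn-penultimate j)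

  swapLast-punchIn-ultimate : ∀ {k} (j : Fin (suc k)) → swapLast (punchIn (ultimate {k}) j) ≡ punchIn penultimate j
  swapLast-punchIn-ultimate {zero}  zero    = ≡.refl
  swapLast-punchIn-ultimate {suc k} zero    = ≡.refl
  swapLast-punchIn-ultimate {suc k} (suc j) = ≡.cong suc (swapLast-punchIn-ultimate j)

  data SwapLastView {k} (i : Fin (2 ℕ.+ k)) : Set where
    fixed         : swapLast i ≡ i → SwapLastView i
    isPenultimate : i ≡ penultimate → SwapLastView i
    isUltimate    : i ≡ ultimate → SwapLastView i

  swapLastView : ∀ {k} (i : Fin (2 ℕ.+ k)) → SwapLastView i
  swapLastView {zero}  zero       = isPenultimate ≡.refl
  swapLastView {zero}  (suc zero) = isUltimate ≡.refl
  swapLastView {suc k} zero       = fixed ≡.refl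
  swapLastView {suc k} (suc i) with swapLastView i
  ... | fixed e         = fixed (≡.cong suc e)
  ... | isPenultimate e = isPenultimate (≡.cong suc e)
  ... | isUltimate e    = isUltimate (≡.cong suc e)

  rename-swapLast-≃ : ∀ {k} (P : Poly (2 ℕ.+ k)) → rename swapLast P ≃ P mod var ultimate -P var penultimate
  rename-swapLast-≃ {k} P = mod-cong ≃-refl (substP-var-id P) ≃-refl (substP-mod swapped P)
    where
    swapped : ∀ i → var (swapLast i) ≃ var i mod var ultimate -P var penultimate
    swapped i with swapLastView i
    ... | fixed e              = ≃⇒≃mod (≃-reflexive (≡.cong var e))
    ... | isPenultimate ≡.refl = via 1P (≃-trans (≃-reflexive (≡.cong var (swapLast-penultimate k)))
      (Solver.solve 2 (λ y z → y := z :+ (y :- z) :* con (1 , 0)) ≃-refl (var ultimate) (var penultimate)))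
    ... | isUltimate ≡.refl    = via (-P 1P) (≃-trans (≃-reflexive (≡.cong var (swapLast-ultimate k)))
      (Solver.solve 2 (λ y z → z := y :+ (y :- z) :* (:- con (1 , 0))) ≃-refl (var ultimate) (var penultimate)))

  rename-O2At : ∀ {a b} (θ : Fin a → Fin b) g x y → rename θ (O2At g x y) ≃ O2At g (θ x) (θ y)
  rename-O2At θ g x y = ≃-trans (rename-∘ θ (pair x y) (O2 g)) (rename-ext (λ { zero → ≡.refl ; (suc _) → ≡.refl }) (O2 g))

  O2At-sym : ∀ {a} g (x y : Fin a) → O2At g x y ≃ O2At g y x
  O2At-sym g x y = ≃-trans (substP-cong _ (≃-sym (O2-swap g)))
    (≃-trans (rename-∘ (pair x y) swap₂ (O2 g)) (rename-ext (λ { zero → ≡.refl ; (suc _) → ≡.refl }) (O2 g)))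

  O2At-divided-difference : ∀ {a} g (x y : Fin a) → (var x -P var y) *P O2At g x y ≃ g at x -P g at y
  O2At-divided-difference g x y = begin
    (var x -P var y) *P O2At g x y                ≈⟨ *-congʳ (rename-var-var (pair x y) zero (suc zero)) _ ⟨
    rename (pair x y) (X₀ -P Y₁) *P O2At g x y    ≈⟨ substP-* _ (X₀ -P Y₁) (O2 g) ⟨
    rename (pair x y) ((X₀ -P Y₁) *P O2 g)        ≈⟨ substP-cong _ (O2-divided-difference g) ⟩
    rename (pair x y) (g at zero -P g at suc zero) ≈⟨ rename-at-at (pair x y) zero (suc zero) g ⟩
    g at x -P g at y                              ∎
    where open ≃-Reasoning

  reduced-O2At : ∀ {k} g (w : Fin (suc (suc k))) y → Reduced w (deg g) (O2At g (punchIn w y) w)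
  reduced-O2At g w y = reduced-rename (pair (punchIn w y) w) (λ _ → y) ≡.refl (λ { zero → ≡.refl }) (O2-reduced g)

  weakenAt-ultimate-at : ∀ {k} g → weakenAt (ultimate {k}) (g at fromℕ k) ≃ g at penultimate
  weakenAt-ultimate-at {k} g = ≃-trans (rename-at (punchIn ultimate) (fromℕ k) g)
                                       (≃-reflexive (≡.cong (g at_) (punchIn-fromℕ (fromℕ k))))

  weakenAt-ultimate-var : ∀ {k} → weakenAt (ultimate {k}) (var (fromℕ k)) ≃ var penultimate
  weakenAt-ultimate-var {k} = ≃-trans (substP-var _ (fromℕ k)) (≃-reflexive (≡.cong var (punchIn-fromℕ (fromℕ k))))

  -- With B₀ the remainder of B modulo g(Xᵤ), D - g(Xₚ) B₀ is a multiple of g(Xᵤ) reduced in Xᵤ.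
  reduced₂-multiple : ∀ {k} g {D A B : Poly (2 ℕ.+ k)} →
                      Reduced ultimate (deg g) D → Reduced penultimate (deg g) D →
                      D ≃ g at ultimate *P A +P g at penultimate *P B → D ≃ 0P
  reduced₂-multiple {k} g {D} {A} {B} rD rD′ D≃ = reduced-multiple penultimate g rD′ D≃Gp*B₀
    where
    open Remainder (divide ultimate g B) renaming (remainder to B₀; remainder-reduced to B₀-reduced; remainder-≃ to B₀≃B)
    Gu = g at ultimate
    Gp = g at penultimate
    q = quotient B₀≃B
    E-reduced : Reduced ultimate (deg g) (D -P Gp *P B₀)
    E-reduced = reduced-− rD (reduced-cong (*-congʳ (weakenAt-ultimate-at g) B₀) (reduced-* (g at fromℕ k) B₀-reduced))
    E≃ : D -P Gp *P B₀ ≃ Gu *P (A -P Gp *P q)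
    E≃ = ≃-trans (+-congˡ D (-‿cong (*-congˡ Gp (≃-quotient B₀≃B)))) (≃-trans (+-congʳ D≃ _)
      (Solver.solve 5 (λ y z a b q → (y :* a :+ z :* b) :- z :* (b :+ y :* q) := y :* (a :- z :* q)) ≃-refl Gu Gp A B q))
    D≃Gp*B₀ : D ≃ Gp *P B₀
    D≃Gp*B₀ = RP.x∙y⁻¹≈ε⇒x≈y D (Gp *P B₀) (reduced-multiple ultimate g E-reduced E≃)

  O2Product-punchIn : ∀ {k} g (l : Fin (suc k)) →
    O2Product g (suc k) ≃ O2At g (inject₁ l) ultimate *P Π k (λ j → O2At g (inject₁ (punchIn l j)) ultimate)
  O2Product-punchIn {k} g l = Π-punchIn k (λ j → O2At g (inject₁ j) ultimate) l

  weakenAt-O2Product : ∀ {k} g (l : Fin (suc k)) →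
    weakenAt (inject₁ l) (O2Product g k) ≃ Π k (λ j → O2At g (inject₁ (punchIn l j)) ultimate)
  weakenAt-O2Product {k} g l = ≃-trans (substP-Π _ k _) (Π-cong k (λ j → ≃-trans (rename-O2At (punchIn (inject₁ l)) g _ _)
    (≃-reflexive (≡.cong₂ (O2At g) (punchIn-inject₁ l j) (punchIn-inject₁-fromℕ l)))))

  horner-penultimate-reduced : ∀ {k} g (f : ℕ → Poly (suc k)) → (∀ i → Reduced (fromℕ k) (deg g) (f i)) →
                               ∀ m → Reduced (ultimate {k}) (deg g) (horner penultimate f m)
  horner-penultimate-reduced g f rf zero    = reduced-0
  horner-penultimate-reduced {k} g f rf (suc m) = reduced-+
    (reduced-rename (punchIn penultimate) inject₁ (punchIn-inject₁-fromℕ (fromℕ k)) punchIn-punchIn (rf 0))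
    (reduced-cong (*-congʳ weakenAt-ultimate-var _)
                  (reduced-* (var (fromℕ k)) (horner-penultimate-reduced g (λ i → f (suc i)) (λ i → rf (suc i)) m)))
    where
    punchIn-punchIn : ∀ j → punchIn (penultimate {k}) (punchIn (fromℕ k) j) ≡ punchIn ultimate (inject₁ j)
    punchIn-punchIn j = ≡.trans (≡.cong (punchIn penultimate) (punchIn-fromℕ j))
      (≡.trans (punchIn-inject₁ (fromℕ k) j) (≡.trans (≡.cong inject₁ (punchIn-fromℕ j)) (≡.sym (punchIn-fromℕ (inject₁ j)))))

  horner-penultimate-≃ : ∀ {k} g (f f′ : ℕ → Poly (suc k)) → (∀ i → f′ i ≃ f i mod g at fromℕ k) →
                         ∀ m → horner penultimate f′ m ≃ horner penultimate f m mod g at (ultimate {k})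
  horner-penultimate-≃ g f f′ f′≃ zero    = mod-refl
  horner-penultimate-≃ {k} g f f′ f′≃ (suc m) = mod-+
    (mod-cong ≃-refl ≃-refl modulus≃ (mod-substP (λ i → var (punchIn penultimate i)) (f′≃ 0)))
    (mod-*ˡ (var penultimate) (horner-penultimate-≃ g (λ i → f (suc i)) (λ i → f′ (suc i)) (λ i → f′≃ (suc i)) m))
    where
    modulus≃ : rename (punchIn penultimate) (g at fromℕ k) ≃ g at ultimate
    modulus≃ = ≃-trans (rename-at (punchIn penultimate) (fromℕ k) g)
                       (≃-reflexive (≡.cong (g at_) (punchIn-inject₁-fromℕ (fromℕ k))))

  -- Π_j O⁽²⁾(X_j, Xᵤ) is reduced in Xₚ, and reducing its Xₚ-coefficients modulo g(Xᵤ)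
  -- yields the remainder O⁽ᵏ⁺²⁾ without destroying that.
  Weil-reduced-penultimate : ∀ {k} g → Reduced penultimate (deg g) (Weil g (2 ℕ.+ k))
  Weil-reduced-penultimate {k} g = reduced-cong (≃-sym W≃W*) (reduced f′ ≃-refl)
    where
    product-reduced : Reduced penultimate (deg g) (O2Product g (suc k))
    product-reduced = reduced-cong
      (≃-sym (≃-trans (O2Product-punchIn g (fromℕ k))
        (≃-trans (*-cong (O2At-sym g _ _) (≃-sym (weakenAt-O2Product g (fromℕ k)))) (*-comm _ _))))
      (reduced-* (O2Product g k)
        (reduced-cong (≃-reflexive (≡.cong (λ w → O2At g w penultimate) (punchIn-inject₁-fromℕ (fromℕ k))))
                      (reduced-O2At g penultimate (fromℕ k))))
    f = coeffs product-reduced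
    f′ : ℕ → Poly (suc k)
    f′ i = remainder (divide (fromℕ k) g (f i))
    W* = horner penultimate f′ (deg g)
    W≃W* : Weil g (2 ℕ.+ k) ≃ W*
    W≃W* = reduced-unique ultimate g (Weil-reduced g (suc k))
      (horner-penultimate-reduced g f′ (λ i → remainder-reduced (divide (fromℕ k) g (f i))) (deg g))
      (mod-trans (Weil-≃-O2Product g (suc k)) (mod-sym
        (mod-cong ≃-refl (≃-sym (≃-horner product-reduced)) ≃-refl
          (horner-penultimate-≃ g f f′ (λ i → remainder-≃ (divide (fromℕ k) g (f i))) (deg g)))))

  -- Swapping Xₚ and Xᵤ fixes O⁽²⁾(Xₚ, Xᵤ) and changes H only modulo Xᵤ - Xₚ, while
  -- (Xₚ - Xᵤ) O⁽²⁾(Xₚ, Xᵤ) = g(Xₚ) - g(Xᵤ).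
  rename-swapLast-difference : ∀ {k} g {W H q q′ : Poly (2 ℕ.+ k)} →
    W ≃ O2At g penultimate ultimate *P H +P g at ultimate *P q →
    rename swapLast H ≃ H +P (var ultimate -P var penultimate) *P q′ →
    rename swapLast W -P W ≃ g at ultimate *P (q′ -P q) +P g at penultimate *P (rename swapLast q -P q′)
  rename-swapLast-difference {k} g {W} {H} {q} {q′} W≃ H≃ = begin
    σW -P W
      ≈⟨ +-cong σW≃ (-‿cong W≃) ⟩
    (O *P (H +P (Y -P Z) *P q′) +P Gp *P σq) -P (O *P H +P Gu *P q)
      ≈⟨ Solver.solve 9 (λ o h y z r gp s gu q → (o :* (h :+ (y :- z) :* r) :+ gp :* s) :- (o :* h :+ gu :* q)
                                            := ((:- ((z :- y) :* o)) :* r :+ gp :* s) :- gu :* q)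
           ≃-refl O H Y Z q′ Gp σq Gu q ⟩
    ((-P ((Z -P Y) *P O)) *P q′ +P Gp *P σq) -P Gu *P q
      ≈⟨ +-congʳ (+-congʳ (*-congʳ (-‿cong (O2At-divided-difference g penultimate ultimate)) q′) _) _ ⟩
    ((-P (Gp -P Gu)) *P q′ +P Gp *P σq) -P Gu *P q
      ≈⟨ Solver.solve 5 (λ gp gu r s q → ((:- (gp :- gu)) :* r :+ gp :* s) :- gu :* q := gu :* (r :- q) :+ gp :* (s :- r))
           ≃-refl Gp Gu q′ σq q ⟩
    Gu *P (q′ -P q) +P Gp *P (σq -P q′) ∎
    where
    open ≃-Reasoning
    σ  = λ i → var {2 ℕ.+ k} (swapLast i)
    σW = rename swapLast W
    σq = rename swapLast q
    Y  = var (ultimate {k})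
    Z  = var (penultimate {k})
    Gu = g at ultimate {k}
    Gp = g at penultimate {k}
    O  = O2At g (penultimate {k}) ultimate
    σO≃O : rename swapLast O ≃ O
    σO≃O = ≃-trans (rename-O2At swapLast g penultimate ultimate)
      (≃-trans (≃-reflexive (≡.cong₂ (O2At g) (swapLast-penultimate k) (swapLast-ultimate k))) (O2At-sym g ultimate penultimate))
    σGu≃Gp : rename swapLast Gu ≃ Gp
    σGu≃Gp = ≃-trans (rename-at swapLast ultimate g) (≃-reflexive (≡.cong (g at_) (swapLast-ultimate k)))
    σW≃ : σW ≃ O *P (H +P (Y -P Z) *P q′) +P Gp *P σq
    σW≃ = begin
      σW                                                      ≈⟨ substP-cong σ W≃ ⟩
      rename swapLast (O *P H +P Gu *P q)                     ≈⟨ substP-+ σ (O *P H) (Gu *P q) ⟩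
      rename swapLast (O *P H) +P rename swapLast (Gu *P q)   ≈⟨ +-cong (substP-* σ O H) (substP-* σ Gu q) ⟩
      rename swapLast O *P rename swapLast H +P rename swapLast Gu *P σq ≈⟨ +-cong (*-cong σO≃O H≃) (*-congʳ σGu≃Gp σq) ⟩
      O *P (H +P (Y -P Z) *P q′) +P Gp *P σq                  ∎

  -- Both sides are reduced in Xᵤ and in Xₚ, and their difference lies in (g(Xᵤ), g(Xₚ)).
  Weil-swapLast : ∀ {k} g → rename swapLast (Weil g (2 ℕ.+ k)) ≃ Weil g (2 ℕ.+ k)
  Weil-swapLast {k} g = RP.x∙y⁻¹≈ε⇒x≈y _ _ (reduced₂-multiple g
    (reduced-− (reduced-rename swapLast (λ j → j) (swapLast-penultimate k) swapLast-punchIn-penultimate W-reduced-p) W-reduced-u)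
    (reduced-− (reduced-rename swapLast (λ j → j) (swapLast-ultimate k) swapLast-punchIn-ultimate W-reduced-u) W-reduced-p)
    (rename-swapLast-difference g
      (≃-trans (≃-quotient (Weil-≃-O2Product g (suc k))) (+-congʳ (O2Product-punchIn g (fromℕ k)) _))
      (≃-quotient (rename-swapLast-≃ (Π k (λ j → O2At g (inject₁ (punchIn (fromℕ k) j)) (ultimate {k})))))))
    where
    W-reduced-u = Weil-reduced g (suc k)
    W-reduced-p = Weil-reduced-penultimate {k} g

  -- Splitting off a linear factor

  module LinearFactor (ζ : R.Carrier) (𝔪 𝔣 : Monic) (𝔣≃ : toPoly 𝔣 ≃ (X₀ -P constP ζ) *P toPoly 𝔪) where

    at-𝔣 : ∀ {n} (v : Fin n) → 𝔣 at v ≃ (var v -P constP ζ) *P 𝔪 at v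
    at-𝔣 v = ≃-trans (substP-cong (λ _ → var v) 𝔣≃) (≃-trans (substP-* (λ _ → var v) (X₀ -P constP ζ) (toPoly 𝔪))
      (*-congʳ (≃-trans (substP-- (λ _ → var v) (X₀ {0}) (constP ζ))
                        (+-cong (substP-var {1} (λ _ → var v) zero) (-‿cong (substP-constP {1} (λ _ → var v) ζ)))) (𝔪 at v)))

    -- (X - Y) kills the difference of the two sides, and X - Y is not a zero divisor.
    O2-𝔣 : O2 𝔣 ≃ 𝔪 at zero +P (Y₁ -P constP ζ) *P O2 𝔪
    O2-𝔣 = RP.x∙y⁻¹≈ε⇒x≈y _ _ (X₀-lift-cancel (var zero) _ (begin
      (X₀ -P Y₁) *P (O2 𝔣 -P (𝔪 at zero +P (Y₁ -P z) *P O2 𝔪))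
        ≈⟨ Solver.solve 6 (λ x y z o a p → (x :- y) :* (o :- (a :+ (y :- z) :* p))
                                          := (x :- y) :* o :- ((x :- y) :* a :+ (y :- z) :* ((x :- y) :* p)))
             ≃-refl X₀ Y₁ z (O2 𝔣) (𝔪 at zero) (O2 𝔪) ⟩
      (X₀ -P Y₁) *P O2 𝔣 -P ((X₀ -P Y₁) *P 𝔪 at zero +P (Y₁ -P z) *P ((X₀ -P Y₁) *P O2 𝔪))
        ≈⟨ +-cong (≃-trans (O2-divided-difference 𝔣) (+-cong (at-𝔣 zero) (-‿cong (at-𝔣 (suc zero)))))
                  (-‿cong (+-congˡ _ (*-congˡ (Y₁ -P z) (O2-divided-difference 𝔪)))) ⟩
      ((X₀ -P z) *P 𝔪 at zero -P (Y₁ -P z) *P 𝔪 at suc zero)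
        -P ((X₀ -P Y₁) *P 𝔪 at zero +P (Y₁ -P z) *P (𝔪 at zero -P 𝔪 at suc zero))
        ≈⟨ Solver.solve 5 (λ x y z a b → ((x :- z) :* a :- (y :- z) :* b) :- ((x :- y) :* a :+ (y :- z) :* (a :- b)) := con (0 , 0))
             ≃-refl X₀ Y₁ z (𝔪 at zero) (𝔪 at suc zero) ⟩
      0P ∎))
      where
      open ≃-Reasoning
      z = constP ζ

    O2At-𝔣 : ∀ {a} (x y : Fin a) → O2At 𝔣 x y ≃ 𝔪 at x +P (var y -P constP ζ) *P O2At 𝔪 x y
    O2At-𝔣 x y = ≃-trans (substP-cong _ O2-𝔣) (≃-trans (substP-+ _ (𝔪 at zero) _)
      (+-cong (rename-at (pair x y) zero 𝔪)
              (≃-trans (substP-* _ (Y₁ -P constP ζ) (O2 𝔪)) (*-congʳ (rename-var-constP (pair x y) (suc zero) ζ) _))))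

    O2At-𝔣′ : ∀ {a} (x y : Fin a) → O2At 𝔣 x y ≃ 𝔪 at y +P (var x -P constP ζ) *P O2At 𝔪 x y
    O2At-𝔣′ x y = ≃-trans (O2At-sym 𝔣 x y) (≃-trans (O2At-𝔣 y x) (+-congˡ _ (*-congˡ _ (O2At-sym 𝔪 y x))))

    linearProduct : ∀ n → Fin (suc n) → Poly (suc n)
    linearProduct n l = prodP (map (λ j → var (punchIn l j) -P constP ζ) (allFin n))

    expansion : ∀ n → Fin (suc n) → Poly (suc n)
    expansion n l = 𝔪 at l *P rename (punchIn l) (Weil 𝔣 n) +P linearProduct n l *P Weil 𝔪 (suc n)

    module _ (deg𝔪<deg𝔣 : deg 𝔪 < deg 𝔣) (k : ℕ) (l : Fin (suc k)) where
      private
        Y : Poly (2 ℕ.+ k)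
        Y = var ultimate
        z : ∀ {n} → Poly n
        z = constP ζ
        a : Fin k → Fin (2 ℕ.+ k)
        a j = inject₁ (punchIn l j)
        E = rename (punchIn (inject₁ l)) (Weil 𝔣 (suc k))
        W𝔪 = Weil 𝔪 (2 ℕ.+ k)
        ΠA = Π k (λ j → O2At 𝔣 (a j) ultimate)
        ΠB = Π k (λ j → var (a j) -P z)
        ΠC = Π k (λ j → O2At 𝔪 (a j) ultimate)
        C  = O2At 𝔪 (inject₁ l) ultimate

        punchIn-inject₁-punchIn : ∀ j → punchIn (inject₁ l) (punchIn (fromℕ k) j) ≡ punchIn ultimate (punchIn l j)
        punchIn-inject₁-punchIn j = ≡.trans (≡.cong (punchIn (inject₁ l)) (punchIn-fromℕ j))
          (≡.trans (punchIn-inject₁ l j) (≡.sym (punchIn-fromℕ (punchIn l j))))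

        weakenAt-ΠB : weakenAt ultimate (Π k (λ j → var (punchIn l j) -P z)) ≃ ΠB
        weakenAt-ΠB = ≃-trans (substP-Π _ k _) (Π-cong k (λ j →
          ≃-trans (rename-var-constP (punchIn ultimate) (punchIn l j) ζ)
                  (≃-reflexive (≡.cong (λ w → var w -P z) (punchIn-fromℕ (punchIn l j))))))

        linearProduct≃ : linearProduct (suc k) (inject₁ l) ≃ (Y -P z) *P ΠB
        linearProduct≃ = ≃-trans (≃-reflexive (prodP-allFin (suc k) factor))
          (≃-trans (Π-punchIn k factor (fromℕ k))
            (*-cong (≃-reflexive (≡.cong (λ w → var w -P z) (punchIn-inject₁-fromℕ l)))
                    (Π-cong k (λ j → ≃-reflexive (≡.cong (λ w → var w -P z) (≡.trans (≡.cong (punchIn (inject₁ l)) (punchIn-fromℕ j)) (punchIn-inject₁ l j)))))))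
          where
          factor : Fin (suc k) → Poly (2 ℕ.+ k)
          factor j = var (punchIn (inject₁ l) j) -P z

      expansion-reduced : Reduced ultimate (deg 𝔣) (expansion (suc k) (inject₁ l))
      expansion-reduced = reduced-+
        (reduced-cong (*-congʳ at-𝔪 E) (reduced-* (𝔪 at l) E-reduced))
        (reduced-cong (≃-trans (*-congʳ weakenAt-ΠB _) (≃-trans (Solver.solve 3 (λ b y w → b :* (y :* w) := (y :* b) :* w) ≃-refl ΠB (Y -P z) W𝔪)
                                                                 (*-congʳ (≃-sym linearProduct≃) W𝔪)))
                      (reduced-* (Π k (λ j → var (punchIn l j) -P z)) factor-reduced))
        where
        at-𝔪 : weakenAt ultimate (𝔪 at l) ≃ 𝔪 at inject₁ l
        at-𝔪 = ≃-trans (rename-at (punchIn ultimate) l 𝔪) (≃-reflexive (≡.cong (𝔪 at_) (punchIn-fromℕ l)))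
        E-reduced : Reduced ultimate (deg 𝔣) E
        E-reduced = reduced-rename (punchIn (inject₁ l)) (punchIn l) (punchIn-inject₁-fromℕ l) punchIn-inject₁-punchIn
                                   (Weil-reduced 𝔣 k)
        factor-reduced : Reduced ultimate (deg 𝔣) ((Y -P z) *P W𝔪)
        factor-reduced = reduced-mono deg𝔪<deg𝔣 (reduced-cong
          (Solver.solve 3 (λ y z w → y :* w :- z :* w := (y :- z) :* w) ≃-refl Y z W𝔪)
          (reduced-− (reduced-var* (Weil-reduced 𝔪 (suc k)))
                     (reduced-mono (ℕ.n≤1+n _) (reduced-cong (*-congʳ (substP-constP (λ i → var (punchIn ultimate i)) ζ) W𝔪)
                                                             (reduced-* (constP ζ) (Weil-reduced 𝔪 (suc k)))))))

      -- By O2At-𝔣 the product splits into 𝔪(X_l) Π_{j≠l} O⁽²⁾_𝔣(X_j, Xᵤ), handled modulo 𝔣(Xᵤ) by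
      -- the congruence for O⁽ᵏ⁺¹⁾_𝔣, and (Xᵤ - ζ) times a term handled modulo 𝔪(Xᵤ).
      O2Product-≃-expansion : O2Product 𝔣 (suc k) ≃ expansion (suc k) (inject₁ l) mod 𝔣 at ultimate
      O2Product-≃-expansion = mod-cong (≃-sym product≃) ≃-refl ≃-refl
        (mod-+ (mod-*ˡ (𝔪 at inject₁ l) (mod-sym E≃ΠA)) (mod-cong ≃-refl (≃-trans (≃-sym (*-assoc _ _ _)) (*-congʳ (≃-sym linearProduct≃) W𝔪)) (≃-sym (at-𝔣 ultimate))
          (mod-scale (Y -P z) (mod-trans (mod-*ˡ C ΠA≃) (mod-cong C*ΠBC≃ ≃-refl ≃-refl (mod-*ˡ ΠB (mod-sym W𝔪≃)))))))
        where
        product≃ : O2Product 𝔣 (suc k) ≃ 𝔪 at inject₁ l *P ΠA +P (Y -P z) *P (C *P ΠA)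
        product≃ = ≃-trans (O2Product-punchIn 𝔣 l) (≃-trans (*-congʳ (O2At-𝔣 (inject₁ l) ultimate) ΠA)
          (Solver.solve 4 (λ g y c p → (g :+ y :* c) :* p := g :* p :+ y :* (c :* p)) ≃-refl (𝔪 at inject₁ l) (Y -P z) C ΠA))
        E≃ΠA : E ≃ ΠA mod 𝔣 at ultimate
        E≃ΠA = mod-cong ≃-refl (weakenAt-O2Product 𝔣 l)
          (≃-trans (rename-at (punchIn (inject₁ l)) (fromℕ k) 𝔣) (≃-reflexive (≡.cong (𝔣 at_) (punchIn-inject₁-fromℕ l))))
          (mod-substP (λ i → var (punchIn (inject₁ l) i)) (Weil-≃-O2Product 𝔣 k))
        ΠA≃ : ΠA ≃ Π k (λ j → (var (a j) -P z) *P O2At 𝔪 (a j) ultimate) mod 𝔪 at ultimate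
        ΠA≃ = mod-Π k _ _ (λ j → via 1P (≃-trans (O2At-𝔣′ (a j) ultimate)
                                          (≃-trans (+-comm _ _) (+-congˡ _ (≃-sym (*-identityʳ _))))))
        C*ΠBC≃ : ΠB *P O2Product 𝔪 (suc k) ≃ C *P Π k (λ j → (var (a j) -P z) *P O2At 𝔪 (a j) ultimate)
        C*ΠBC≃ = ≃-trans (*-congˡ ΠB (O2Product-punchIn 𝔪 l))
          (≃-trans (Solver.solve 3 (λ b c p → b :* (c :* p) := c :* (b :* p)) ≃-refl ΠB C ΠC)
                   (*-congˡ C (≃-sym (Π-* k (λ j → var (a j) -P z) (λ j → O2At 𝔪 (a j) ultimate)))))
        W𝔪≃ : W𝔪 ≃ O2Product 𝔪 (suc k) mod 𝔪 at ultimate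
        W𝔪≃ = Weil-≃-O2Product 𝔪 (suc k)

      Weil-expansion-inject₁ : Weil 𝔣 (2 ℕ.+ k) ≃ expansion (suc k) (inject₁ l)
      Weil-expansion-inject₁ = reduced-unique ultimate 𝔣 (Weil-reduced 𝔣 (suc k)) expansion-reduced
                                           (mod-trans (Weil-≃-O2Product 𝔣 (suc k)) O2Product-≃-expansion)

    rename-swapLast-expansion : ∀ k → rename swapLast (expansion (suc k) penultimate) ≃ expansion (suc k) ultimate
    rename-swapLast-expansion k = ≃-trans (substP-+ σ (𝔪 at penultimate *P E) (linearProduct (suc k) penultimate *P W𝔪))
      (+-cong (≃-trans (substP-* σ (𝔪 at penultimate) E) (*-cong at≃ E≃))
              (≃-trans (substP-* σ (linearProduct (suc k) penultimate) W𝔪) (*-cong linearProduct≃ (Weil-swapLast 𝔪))))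
      where
      σ = λ i → var {2 ℕ.+ k} (swapLast i)
      E = rename (punchIn penultimate) (Weil 𝔣 (suc k))
      W𝔪 = Weil 𝔪 (2 ℕ.+ k)
      factor : Fin (2 ℕ.+ k) → Fin (suc k) → Poly (2 ℕ.+ k)
      factor v j = var (punchIn v j) -P constP ζ
      at≃ : rename swapLast (𝔪 at penultimate) ≃ 𝔪 at ultimate
      at≃ = ≃-trans (rename-at swapLast penultimate 𝔪) (≃-reflexive (≡.cong (𝔪 at_) (swapLast-penultimate k)))
      E≃ : rename swapLast E ≃ rename (punchIn ultimate) (Weil 𝔣 (suc k))
      E≃ = ≃-trans (rename-∘ swapLast (punchIn penultimate) (Weil 𝔣 (suc k)))
                   (rename-ext swapLast-punchIn-penultimate (Weil 𝔣 (suc k)))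
      linearProduct≃ : rename swapLast (linearProduct (suc k) penultimate) ≃ linearProduct (suc k) ultimate
      linearProduct≃ = ≃-trans (substP-cong σ (≃-reflexive (prodP-allFin (suc k) (factor penultimate))))
        (≃-trans (substP-Π σ (suc k) (factor penultimate))
        (≃-trans (Π-cong (suc k) (λ j → ≃-trans (rename-var-constP swapLast (punchIn penultimate j) ζ)
                                                (≃-reflexive (≡.cong (λ w → var w -P constP ζ) (swapLast-punchIn-penultimate j)))))
                 (≃-sym (≃-reflexive (prodP-allFin (suc k) (factor ultimate))))))

    Weil-expansion : deg 𝔪 < deg 𝔣 → ∀ k (l : Fin (2 ℕ.+ k)) → Weil 𝔣 (2 ℕ.+ k) ≃ expansion (suc k) l
    Weil-expansion deg𝔪<deg𝔣 k l with Top.view l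
    ... | Top.‵inject₁ l′ = Weil-expansion-inject₁ deg𝔪<deg𝔣 k l′
    ... | Top.‵fromℕ      = begin
      Weil 𝔣 (2 ℕ.+ k)                          ≈⟨ Weil-swapLast 𝔣 ⟨
      rename swapLast (Weil 𝔣 (2 ℕ.+ k))        ≈⟨ substP-cong _ (Weil-expansion-inject₁ deg𝔪<deg𝔣 k (fromℕ k)) ⟩
      rename swapLast (expansion (suc k) penultimate) ≈⟨ rename-swapLast-expansion k ⟩
      expansion (suc k) ultimate                      ∎
      where open ≃-Reasoning

  deg-linearFactor : ¬ (R.0# R.≈ R.1#) → ∀ ζ (𝔪 𝔣 : Monic) → toPoly 𝔣 ≃ (X₀ -P constP ζ) *P toPoly 𝔪 → deg 𝔪 < deg 𝔣
  deg-linearFactor 0≉1 ζ 𝔪 𝔣 𝔣≃ with deg 𝔪 ℕ.<? deg 𝔣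
  ... | yes lt = lt
  ... | no ¬lt = contradiction (R.sym (unwrap (degreeBelow-1 1 ℕ.≤-refl))) 0≉1
    where
    F = L.monic (map cst 𝔣)
    M = L.monic (map cst 𝔪)
    Q = addL _+P_ (0P ∷ 1P ∷ []) (map -P_ (cst ζ ∷ []))
    length-F : length F ≡ deg 𝔣 ℕ.+ 1
    length-F = ≡.trans (length-++ (map cst 𝔣)) (≡.cong (ℕ._+ 1) (length-map cst 𝔣))
    QM-degree : L.DegreeBelow (Q L.*L M) (length (map cst 𝔪) ℕ.+ 1)
    QM-degree i le = ≃-trans (≃-sym (L.at (pol-injective 𝔣≃) i)) (L.degreeBelow-length F i (begin
      length F                    ≡⟨ length-F ⟩
      deg 𝔣 ℕ.+ 1                 ≤⟨ ℕ.+-monoˡ-≤ 1 (ℕ.≮⇒≥ ¬lt) ⟩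
      deg 𝔪 ℕ.+ 1                 ≡⟨ ≡.cong (ℕ._+ 1) (length-map cst 𝔪) ⟨
      length (map cst 𝔪) ℕ.+ 1    ≤⟨ le ⟩
      i                           ∎))
      where open ℕ.≤-Reasoning
    degreeBelow-1 : L.DegreeBelow Q 1
    degreeBelow-1 = L.degreeBelow-*-monic (map cst 𝔪) 1 Q QM-degree

corollary2p16 : ∀ {c ℓ} (R : CommutativeRing c ℓ) → IsFiniteField R →
  let open CommutativeRing R using (Carrier)
      open Poly R
  in (n : ℕ) → 1 ≤ n →
     (ζ : Carrier) (𝔪 𝔣 : Monic) →
     toPoly 𝔣 ≈P (var zero -P constP ζ) *P toPoly 𝔪 →
     (l : Fin (suc n)) →
     Weil 𝔣 (suc n)
       ≈P substP (λ _ → var l) (toPoly 𝔪)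
            *P substP (λ j → var (punchIn l j)) (Weil 𝔣 n)
          +P prodP (map (λ j → var (punchIn l j) -P constP ζ) (allFin n))
            *P Weil 𝔪 (suc n)
corollary2p16 R (0≉1 , _) (suc k) (s≤s z≤n) ζ 𝔪 𝔣 𝔣≃ l =
  unwrap (Weil-expansion (deg-linearFactor 0≉1 ζ 𝔪 𝔣 ⟨ 𝔣≃ ⟩) k l)
  where
  open PolynomialRing R using (⟨_⟩; unwrap)
  open Multivariate R using (deg-linearFactor; module LinearFactor)
  open LinearFactor ζ 𝔪 𝔣 ⟨ 𝔣≃ ⟩ using (Weil-expansion)
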